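{- Let $\times$ be the cross product on $\mathbb{R}^3$, and let $\Join$ be the bilinear product on $\mathbb{R}^3$ defined on the standard basis $\{\mathbf i,\mathbf j,\mathbf k\}$ by $x\Join x=0$ for each basis vector $x$ and $x\Join y=z$ for distinct basis vectors $x,y$ where $z$ is the third basis vector, i.e. $(\alpha\mathbf i+\beta\mathbf j+\gamma\mathbf k)\Join(\alpha'\mathbf i+\beta'\mathbf j+\gamma'\mathbf k)=(\beta\gamma'+\gamma\beta')\mathbf i+(\gamma\alpha'+\alpha\gamma')\mathbf j+(\alpha\beta'+\beta\alpha')\mathbf k$. Then $s^{\mathrm{ac}}_n(\Join)=D_{n-1}$ for all $n\ge1$, $s^{\mathrm{ac}}_n(\times)=2D_{n-1}$ for all $n\ge2$, and $s_n(\times)=s_n(\Join)=C_{n-1}$ for all $n\ge1$.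
   Context: For $X_n=\{x_1,\dots,x_n\}$, groupoid terms are built recursively from variables by $(s,t)\mapsto(st)$; a full linear term over $X_n$ is a term in which each variable occurs exactly once, and a bracketing is a full linear term with variables in order $x_1,\dots,x_n$ from left to right. For a binary operation $\circ$ on a set, $s^{\mathrm{ac}}_n(\circ)$ (resp. $s_n(\circ)$) is the number of distinct $n$-ary term operations induced by full linear terms (resp. bracketings) over $X_n$. $C_m=\frac{1}{m+1}\binom{2m}{m}$, $D_m=(2m)!/(2^mm!)$. -}

module Defs where

open import Data.Nat as N using (ℕ; zero; suc; NonZero; _!)
open import Data.Nat.Properties using (m*n≢0; m^n≢0; _!≢0)
open import Data.Nat.Combinatorics using (_C_)
open import Data.Fin using (Fin)
open import Data.Fin.Properties using () renaming (_≟_ to _≟ᶠ_)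
open import Data.List using (List; []; [_]; _++_; allFin)
open import Data.Product using (Σ; ∃; _×_; _,_)
open import Data.Sum using (_⊎_)
open import Relation.Nullary using (¬_; yes; no)
open import Relation.Binary.PropositionalEquality using (_≡_)
open import Relation.Binary.Structures using (IsStrictTotalOrder)
open import Algebra.Structures using (IsCommutativeRing)

Catalan : ℕ → ℕ
Catalan m = ((2 N.* m) C m) N./ suc m

DoubleFact : ℕ → ℕ
DoubleFact m = ((2 N.* m) !) N./ (2 N.^ m N.* m !)
  where instance
          _ = m^n≢0 2 m
          _ = m !≢0
          _ = m*n≢0 (2 N.^ m) (m !)

-- The real numbers, axiomatised as a complete ordered field
-- (any model is isomorphic to ℝ).

record RealNumbers : Set₁ where
  infix  4 _≈_ _<_ _≤_
  infixl 6 _+_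
  infixl 7 _*_
  field
    R   : Set
    _≈_ : R → R → Set
    _+_ : R → R → R
    _*_ : R → R → R
    -_  : R → R
    0r  : R
    1r  : R
    _<_ : R → R → Set
    isCommutativeRing : IsCommutativeRing _≈_ _+_ _*_ -_ 0r 1r
    *-inverse : ∀ x → ¬ (x ≈ 0r) → ∃ λ y → x * y ≈ 1r
    <-isStrictTotalOrder : IsStrictTotalOrder _≈_ _<_
    0<1 : 0r < 1r
    +-mono-< : ∀ x y z → x < y → x + z < y + z
    *-pos : ∀ x y → 0r < x → 0r < y → 0r < x * y

  _≤_ : R → R → Set
  x ≤ y = x < y ⊎ x ≈ y

  field
    sup : (P : R → Set) → ∃ P → (∃ λ b → ∀ x → P x → x ≤ b) →
          ∃ λ s → (∀ x → P x → x ≤ s) × (∀ b → (∀ x → P x → x ≤ b) → s ≤ b)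

-- Groupoid terms over X_n = {x_1,...,x_n} (variable x_{i+1} is var i)

infixl 7 _·_
data Term (n : ℕ) : Set where
  var : Fin n → Term n
  _·_ : Term n → Term n → Term n

occ : ∀ {n} → Fin n → Term n → ℕ
occ i (var j) with i ≟ᶠ j
... | yes _ = 1
... | no  _ = 0
occ i (s · t) = occ i s N.+ occ i t

leaves : ∀ {n} → Term n → List (Fin n)
leaves (var i) = [ i ]
leaves (s · t) = leaves s ++ leaves t

FullLinear : ∀ {n} → Term n → Set
FullLinear {n} t = ∀ (i : Fin n) → occ i t ≡ 1

Bracketing : ∀ {n} → Term n → Set
Bracketing {n} t = FullLinear t × leaves t ≡ allFin n

module _ (ℝ : RealNumbers) where
  open RealNumbers ℝ

  V3 : Set
  V3 = R × R × R

  _≈₃_ : V3 → V3 → Set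
  (a , b , c) ≈₃ (a' , b' , c') = (a ≈ a') × (b ≈ b') × (c ≈ c')

  private
    infixl 6 _−_
    _−_ : R → R → R
    x − y = x + (- y)

  cross : V3 → V3 → V3
  cross (α , β , γ) (α' , β' , γ') =
    (β * γ' − γ * β' , γ * α' − α * γ' , α * β' − β * α')

  join : V3 → V3 → V3
  join (α , β , γ) (α' , β' , γ') =
    (β * γ' + γ * β' , γ * α' + α * γ' , α * β' + β * α')

  termOp : ∀ {n} → (V3 → V3 → V3) → Term n → (Fin n → V3) → V3
  termOp _∘_ (var i) v = v i
  termOp _∘_ (s · t) v = termOp _∘_ s v ∘ termOp _∘_ t v

  SameOp : ∀ {n} → ((Fin n → V3) → V3) → ((Fin n → V3) → V3) → Set
  SameOp {n} f g = ∀ (v : Fin n → V3) → f v ≈₃ g v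

  -- The terms satisfying P induce exactly k distinct n-ary term operations
  -- of _∘_: there are k such terms with pairwise distinct operations, and
  -- every such term induces one of these k operations.
  NumOps : ∀ {n} → (Term n → Set) → (V3 → V3 → V3) → ℕ → Set
  NumOps {n} P _∘_ k =
    Σ (Fin k → Term n) λ ts →
      (∀ a → P (ts a)) ×
      (∀ a b → SameOp (termOp _∘_ (ts a)) (termOp _∘_ (ts b)) → a ≡ b) ×
      (∀ t → P t → ∃ λ a → SameOp (termOp _∘_ t) (termOp _∘_ (ts a)))

  s-ac : (n : ℕ) → (V3 → V3 → V3) → ℕ → Set
  s-ac n _∘_ k = NumOps {n} FullLinear _∘_ k

  s-br : (n : ℕ) → (V3 → V3 → V3) → ℕ → Set
  s-br n _∘_ k = NumOps {n} Bracketing _∘_ k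

-- Colour the variables by 𝟎 and the basis vectors 𝐢, 𝐣, 𝐤 of ℝ³. On these vectors ⋈ acts like the
-- Klein four-group product restricted to distinct nonzero factors, and × does the same up to sign, so a
-- linear term evaluates to 0 or to ± the basis vector that is the group sum of the colours of its leaves.
-- Call a linear term canonical if in each product the left factor has the smaller least variable. Two
-- distinct canonical terms in the same variables are separated by a colouring making one of them nonzero
-- and the other zero: where their outermost factorisations split the variables differently, one prescribes
-- the value of the first term together with the group sum of the colours of the variables of a factor of
-- the second, making that factor vanish. Every linear term is a canonical one up to commuting factors,
-- which does not change its ⋈-operation and changes its ×-operation at most by a sign, while a product and
-- its mirror image always give different ×-operations. The canonical full linear terms in x₀, …, x_j arise
-- exactly once each by grafting x_j onto one of the 2j − 1 subterms of a canonical term in x₀, …, x_(j−1),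
-- so there are D_j of them. A bracketing is determined by its shape, a binary tree, and binary trees are
-- counted by the Catalan numbers through the ballot formula for forests.

module Submission where

open import Defs
open import Data.Nat as ℕ using (ℕ; zero; suc; _+_; _*_; _^_; _/_; _!; _≤_; _<_; _∸_; z≤n; s≤s; NonZero)
open import Data.Nat.DivMod using (m*n/n≡m)
open import Data.Nat.Combinatorics using (_C_; nCk+nC[k+1]≡[n+1]C[k+1]; nCk≡nC[n∸k])
open import Data.Nat.Tactic.RingSolver using (solve-∀)
import Data.Nat.Properties as ℕₚ
open import Data.Nat.ListAction using (sum)
open import Data.Nat.ListAction.Properties using (sum-++)
open import Data.Fin as Fin using (Fin; toℕ) renaming (zero to fz; suc to fs)
import Data.Fin.Properties as Finₚ
open import Data.Bool as Bool using (Bool; true; false; _xor_; if_then_else_; _∧_; _∨_; not; T)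
open import Data.Bool.Properties using (xor-assoc; xor-comm; xor-same; xor-identityʳ)
open import Data.Product using (Σ; ∃; ∃₂; _×_; _,_; proj₁; proj₂; uncurry)
open import Data.Product.Properties using (≡-dec)
open import Data.Product.Properties.WithK using (,-injectiveʳ)
open import Data.Sum using (_⊎_; inj₁; inj₂; [_,_])
open import Data.Empty using (⊥; ⊥-elim)
open import Data.Unit using (⊤; tt)
open import Data.Vec as Vec using (Vec; []; _∷_)
import Data.Vec.Properties as Vecₚ
open import Data.List as List using (List)
import Data.List.Properties as Listₚ
open import Data.List.Relation.Unary.All using (All; _∷_)
import Data.List.Relation.Unary.All.Properties as Allₚ
open import Data.List.Relation.Unary.AllPairs using (AllPairs; _∷_)
import Data.List.Relation.Unary.AllPairs.Properties as AllPairsₚ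
open import Function using (_∘_; id)
open import Relation.Nullary using (¬_; Dec; yes; no; ¬?; does)
open import Relation.Nullary.Decidable using (_×-dec_; dec-true; dec-false; map′)
open import Relation.Binary.PropositionalEquality
  using (_≡_; _≢_; refl; sym; trans; cong; cong₂; subst; module ≡-Reasoning)
open import Relation.Binary using (DecidableEquality; tri<; tri≈; tri>; IsStrictTotalOrder; Setoid)
open import Algebra.Bundles using (CommutativeRing)
import Algebra.Properties.Ring as RingProperties
import Relation.Binary.Reasoning.Setoid as SetoidReasoning

Klein : Set
Klein = Bool × Bool

pattern 𝟎 = (false , false)
pattern 𝐢 = (true  , false)
pattern 𝐣 = (false , true)
pattern 𝐤 = (true  , true)

infix 4 _≟ₖ_
_≟ₖ_ : DecidableEquality Klein
_≟ₖ_ = ≡-dec Bool._≟_ Bool._≟_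

infixl 6 _⊕_
_⊕_ : Klein → Klein → Klein
(a , b) ⊕ (c , d) = a xor c , b xor d

⊕-assoc : ∀ x y z → (x ⊕ y) ⊕ z ≡ x ⊕ (y ⊕ z)
⊕-assoc (a , b) (c , d) (e , f) = cong₂ _,_ (xor-assoc a c e) (xor-assoc b d f)

⊕-comm : ∀ x y → x ⊕ y ≡ y ⊕ x
⊕-comm (a , b) (c , d) = cong₂ _,_ (xor-comm a c) (xor-comm b d)

⊕-identityʳ : ∀ x → x ⊕ 𝟎 ≡ x
⊕-identityʳ (a , b) = cong₂ _,_ (xor-identityʳ a) (xor-identityʳ b)

⊕-self : ∀ x → x ⊕ x ≡ 𝟎
⊕-self (a , b) = cong₂ _,_ (xor-same a) (xor-same b)

⊕-cancelˡ : ∀ x y → x ⊕ (x ⊕ y) ≡ y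
⊕-cancelˡ x y = trans (sym (⊕-assoc x x y)) (cong (_⊕ y) (⊕-self x))

⊕-cancelʳ : ∀ x y → (x ⊕ y) ⊕ y ≡ x
⊕-cancelʳ x y = trans (⊕-assoc x y y) (trans (cong (x ⊕_) (⊕-self y)) (⊕-identityʳ x))

⊕≡𝟎⇒≡ : ∀ x y → x ⊕ y ≡ 𝟎 → x ≡ y
⊕≡𝟎⇒≡ x y e = trans (sym (⊕-cancelʳ x y)) (trans (cong (_⊕ y) e) refl)

⊕≡ˡ⇒𝟎 : ∀ x y → x ⊕ y ≡ x → y ≡ 𝟎
⊕≡ˡ⇒𝟎 x y e = trans (sym (⊕-cancelˡ x y)) (trans (cong (x ⊕_) e) (⊕-self x))

Distinct : Klein → Klein → Set
Distinct x y = x ≢ 𝟎 × y ≢ 𝟎 × x ≢ y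

Distinct-sym : ∀ {x y} → Distinct x y → Distinct y x
Distinct-sym (x≢𝟎 , y≢𝟎 , x≢y) = y≢𝟎 , x≢𝟎 , x≢y ∘ sym

-- Read 𝟎, 𝐢, 𝐣, 𝐤 as the zero vector and the standard basis of ℝ³; then _⋈_ is the restriction of ⋈ (Reals.join-vec).
infixl 7 _⋈_
_⋈_ : Klein → Klein → Klein
𝐢 ⋈ 𝐣 = 𝐤
𝐣 ⋈ 𝐢 = 𝐤
𝐣 ⋈ 𝐤 = 𝐢
𝐤 ⋈ 𝐣 = 𝐢
𝐤 ⋈ 𝐢 = 𝐣
𝐢 ⋈ 𝐤 = 𝐣
_ ⋈ _ = 𝟎

⋈-zeroʳ : ∀ x → x ⋈ 𝟎 ≡ 𝟎
⋈-zeroʳ 𝟎 = refl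
⋈-zeroʳ 𝐢 = refl
⋈-zeroʳ 𝐣 = refl
⋈-zeroʳ 𝐤 = refl

⋈≡⊕ : ∀ {x y} → Distinct x y → x ⋈ y ≡ x ⊕ y
⋈≡⊕ {𝐢} {𝐣} _ = refl
⋈≡⊕ {𝐢} {𝐤} _ = refl
⋈≡⊕ {𝐣} {𝐢} _ = refl
⋈≡⊕ {𝐣} {𝐤} _ = refl
⋈≡⊕ {𝐤} {𝐢} _ = refl
⋈≡⊕ {𝐤} {𝐣} _ = refl
⋈≡⊕ {𝟎} (x≢𝟎 , _ , _) = ⊥-elim (x≢𝟎 refl)
⋈≡⊕ {_} {𝟎} (_ , y≢𝟎 , _) = ⊥-elim (y≢𝟎 refl)
⋈≡⊕ {𝐢} {𝐢} (_ , _ , x≢y) = ⊥-elim (x≢y refl)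
⋈≡⊕ {𝐣} {𝐣} (_ , _ , x≢y) = ⊥-elim (x≢y refl)
⋈≡⊕ {𝐤} {𝐤} (_ , _ , x≢y) = ⊥-elim (x≢y refl)

⋈≢𝟎⇒Distinct : ∀ x y → x ⋈ y ≢ 𝟎 → Distinct x y
⋈≢𝟎⇒Distinct 𝐢 𝐣 _ = (λ ()) , (λ ()) , (λ ())
⋈≢𝟎⇒Distinct 𝐢 𝐤 _ = (λ ()) , (λ ()) , (λ ())
⋈≢𝟎⇒Distinct 𝐣 𝐢 _ = (λ ()) , (λ ()) , (λ ())
⋈≢𝟎⇒Distinct 𝐣 𝐤 _ = (λ ()) , (λ ()) , (λ ())
⋈≢𝟎⇒Distinct 𝐤 𝐢 _ = (λ ()) , (λ ()) , (λ ())
⋈≢𝟎⇒Distinct 𝐤 𝐣 _ = (λ ()) , (λ ()) , (λ ())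
⋈≢𝟎⇒Distinct 𝟎 _ h = ⊥-elim (h refl)
⋈≢𝟎⇒Distinct 𝐢 𝟎 h = ⊥-elim (h refl)
⋈≢𝟎⇒Distinct 𝐣 𝟎 h = ⊥-elim (h refl)
⋈≢𝟎⇒Distinct 𝐤 𝟎 h = ⊥-elim (h refl)
⋈≢𝟎⇒Distinct 𝐢 𝐢 h = ⊥-elim (h refl)
⋈≢𝟎⇒Distinct 𝐣 𝐣 h = ⊥-elim (h refl)
⋈≢𝟎⇒Distinct 𝐤 𝐤 h = ⊥-elim (h refl)

Distinct⇒⋈≢𝟎 : ∀ {x y} → Distinct x y → x ⋈ y ≢ 𝟎
Distinct⇒⋈≢𝟎 {x} {y} d@(_ , _ , x≢y) e = x≢y (⊕≡𝟎⇒≡ x y (trans (sym (⋈≡⊕ d)) e))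

⋈-comm : ∀ x y → x ⋈ y ≡ y ⋈ x
⋈-comm x y with x ⋈ y ≟ₖ 𝟎 | y ⋈ x ≟ₖ 𝟎
... | yes p | yes q = trans p (sym q)
... | yes p | no q  = ⊥-elim (Distinct⇒⋈≢𝟎 (Distinct-sym (⋈≢𝟎⇒Distinct y x q)) p)
... | no p  | _     = trans (⋈≡⊕ d) (trans (⊕-comm x y) (sym (⋈≡⊕ (Distinct-sym d))))
  where d = ⋈≢𝟎⇒Distinct x y p

Distinct-⊕ : ∀ {s y} → Distinct s y → Distinct y (s ⊕ y)
Distinct-⊕ {s} {y} (s≢𝟎 , y≢𝟎 , s≢y) =
  y≢𝟎 , s≢y ∘ ⊕≡𝟎⇒≡ s y , λ e → s≢𝟎 (⊕≡ˡ⇒𝟎 y s (trans (⊕-comm y s) (sym e)))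

Distinct-⊕ʳ : ∀ {s y} → Distinct s y → Distinct (s ⊕ y) s
Distinct-⊕ʳ {s} {y} d@(s≢𝟎 , y≢𝟎 , _) =
  proj₁ (proj₂ (Distinct-⊕ d)) , s≢𝟎 , y≢𝟎 ∘ ⊕≡ˡ⇒𝟎 s y

⋈-split : ∀ {s y} → Distinct s y → y ⋈ (s ⊕ y) ≡ s
⋈-split {s} {y} d = trans (⋈≡⊕ (Distinct-⊕ d)) (trans (⊕-comm y (s ⊕ y)) (⊕-cancelʳ s y))

⋈-split′ : ∀ {s y} → Distinct s y → (s ⊕ y) ⋈ y ≡ s
⋈-split′ {s} {y} d = trans (⋈-comm (s ⊕ y) y) (⋈-split d)

another : Klein → Klein
another 𝟎 = 𝐢
another 𝐢 = 𝐣
another 𝐣 = 𝐤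
another 𝐤 = 𝐢

another-Distinct : ∀ {s} → s ≢ 𝟎 → Distinct s (another s)
another-Distinct {𝟎} s≢𝟎 = ⊥-elim (s≢𝟎 refl)
another-Distinct {𝐢} _ = (λ ()) , (λ ()) , (λ ())
another-Distinct {𝐣} _ = (λ ()) , (λ ()) , (λ ())
another-Distinct {𝐤} _ = (λ ()) , (λ ()) , (λ ())

infixr 8 _⊙_
_⊙_ : ℕ → Klein → Klein
zero  ⊙ x = 𝟎
suc m ⊙ x = x ⊕ m ⊙ x

⊕-interchange : ∀ w x y z → (w ⊕ x) ⊕ (y ⊕ z) ≡ (w ⊕ y) ⊕ (x ⊕ z)
⊕-interchange w x y z = begin
  (w ⊕ x) ⊕ (y ⊕ z)  ≡⟨ ⊕-assoc w x (y ⊕ z) ⟩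
  w ⊕ (x ⊕ (y ⊕ z))  ≡⟨ cong (w ⊕_) (sym (⊕-assoc x y z)) ⟩
  w ⊕ ((x ⊕ y) ⊕ z)  ≡⟨ cong (λ v → w ⊕ (v ⊕ z)) (⊕-comm x y) ⟩
  w ⊕ ((y ⊕ x) ⊕ z)  ≡⟨ cong (w ⊕_) (⊕-assoc y x z) ⟩
  w ⊕ (y ⊕ (x ⊕ z))  ≡⟨ sym (⊕-assoc w y (x ⊕ z)) ⟩
  (w ⊕ y) ⊕ (x ⊕ z)  ∎
  where open ≡-Reasoning

⊙-+ : ∀ m m′ x → (m + m′) ⊙ x ≡ m ⊙ x ⊕ m′ ⊙ x
⊙-+ zero    m′ x = refl
⊙-+ (suc m) m′ x = trans (cong (x ⊕_) (⊙-+ m m′ x)) (sym (⊕-assoc x (m ⊙ x) (m′ ⊙ x)))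

⊙-𝟎 : ∀ m → m ⊙ 𝟎 ≡ 𝟎
⊙-𝟎 zero    = refl
⊙-𝟎 (suc m) = ⊙-𝟎 m

⨁ : ∀ {n} → (Fin n → Klein) → Klein
⨁ {zero}  f = 𝟎
⨁ {suc n} f = f fz ⊕ ⨁ (f ∘ fs)

⨁-cong : ∀ {n} {f g : Fin n → Klein} → (∀ i → f i ≡ g i) → ⨁ f ≡ ⨁ g
⨁-cong {zero}  f≗g = refl
⨁-cong {suc n} f≗g = cong₂ _⊕_ (f≗g fz) (⨁-cong (f≗g ∘ fs))

⨁-⊕ : ∀ {n} (f g : Fin n → Klein) → ⨁ (λ i → f i ⊕ g i) ≡ ⨁ f ⊕ ⨁ g
⨁-⊕ {zero}  f g = refl
⨁-⊕ {suc n} f g =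
  trans (cong (f fz ⊕ g fz ⊕_) (⨁-⊕ (f ∘ fs) (g ∘ fs))) (⊕-interchange (f fz) (g fz) _ _)

⨁-𝟎 : ∀ {n} (f : Fin n → Klein) → (∀ i → f i ≡ 𝟎) → ⨁ f ≡ 𝟎
⨁-𝟎 {zero}  f f≗𝟎 = refl
⨁-𝟎 {suc n} f f≗𝟎 = cong₂ _⊕_ (f≗𝟎 fz) (⨁-𝟎 (f ∘ fs) (f≗𝟎 ∘ fs))

module _ {n : ℕ} where

  occ-var-≡ : (i : Fin n) → occ i (var i) ≡ 1
  occ-var-≡ i with i Finₚ.≟ i
  ... | yes _  = refl
  ... | no i≢i = ⊥-elim (i≢i refl)

  occ-var-≢ : {i j : Fin n} → i ≢ j → occ i (var j) ≡ 0
  occ-var-≢ {i} {j} i≢j with i Finₚ.≟ j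
  ... | yes i≡j = ⊥-elim (i≢j i≡j)
  ... | no _    = refl

  data Occurs (i : Fin n) : Term n → Set where
    here  : Occurs i (var i)
    left  : ∀ {a b} → Occurs i a → Occurs i (a · b)
    right : ∀ {a b} → Occurs i b → Occurs i (a · b)

  Occurs⇒occ≢0 : ∀ {i t} → Occurs i t → occ i t ≢ 0
  Occurs⇒occ≢0 {i} here            = ℕₚ.1+n≢0 ∘ trans (sym (occ-var-≡ i))
  Occurs⇒occ≢0 {i} (left {a} a∋i)  = Occurs⇒occ≢0 a∋i ∘ ℕₚ.m+n≡0⇒m≡0 (occ i a)
  Occurs⇒occ≢0 {i} (right {a} b∋i) = Occurs⇒occ≢0 b∋i ∘ ℕₚ.m+n≡0⇒n≡0 (occ i a)

  occ≢0⇒Occurs : ∀ {i} t → occ i t ≢ 0 → Occurs i t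
  occ≢0⇒Occurs {i} (var j) h with i Finₚ.≟ j
  ... | yes refl = here
  ... | no _     = ⊥-elim (h refl)
  occ≢0⇒Occurs {i} (a · b) h with occ i a ℕ.≟ 0
  ... | no  a∋i  = left (occ≢0⇒Occurs a a∋i)
  ... | yes a∌i = right (occ≢0⇒Occurs b λ b∌i → h (cong₂ _+_ a∌i b∌i))

  Occurs? : ∀ i t → Dec (Occurs i t)
  Occurs? i t = map′ (occ≢0⇒Occurs t) Occurs⇒occ≢0 (¬? (occ i t ℕ.≟ 0))

  Occurs-var⇒≡ : ∀ {i j} → Occurs i (var j) → i ≡ j
  Occurs-var⇒≡ here = refl

  ¬Occurs⇒occ≡0 : ∀ {i} t → ¬ Occurs i t → occ i t ≡ 0
  ¬Occurs⇒occ≡0 {i} t t∌i with occ i t ℕ.≟ 0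
  ... | yes occ≡0 = occ≡0
  ... | no  occ≢0 = ⊥-elim (t∌i (occ≢0⇒Occurs t occ≢0))

  Occurs-·-¬ˡ : ∀ {i a b} → Occurs i (a · b) → ¬ Occurs i a → Occurs i b
  Occurs-·-¬ˡ (left  a∋i) a∌i = ⊥-elim (a∌i a∋i)
  Occurs-·-¬ˡ (right b∋i) _   = b∋i

  Disjoint : Term n → Term n → Set
  Disjoint a b = ∀ i → Occurs i a → Occurs i b → ⊥

  data Linear : Term n → Set where
    var  : ∀ i → Linear (var i)
    node : ∀ {a b} → Linear a → Linear b → Disjoint a b → Linear (a · b)

  Linear-occ : ∀ {t} → Linear t → ∀ i → occ i t ≡ 0 ⊎ occ i t ≡ 1
  Linear-occ (var j) i with i Finₚ.≟ j
  ... | yes _ = inj₂ refl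
  ... | no  _ = inj₁ refl
  Linear-occ {a · b} (node la lb disj) i with Linear-occ la i | Linear-occ lb i
  ... | inj₁ a∌i | inj₁ b∌i = inj₁ (cong₂ _+_ a∌i b∌i)
  ... | inj₁ a∌i | inj₂ b∋i = inj₂ (cong₂ _+_ a∌i b∋i)
  ... | inj₂ a∋i | inj₁ b∌i = inj₂ (cong₂ _+_ a∋i b∌i)
  ... | inj₂ a∋i | inj₂ b∋i = ⊥-elim (disj i (occ≡1⇒Occurs a a∋i) (occ≡1⇒Occurs b b∋i))
    where
    occ≡1⇒Occurs : ∀ t → occ i t ≡ 1 → Occurs i t
    occ≡1⇒Occurs t e = occ≢0⇒Occurs t λ e′ → ℕₚ.1+n≢0 (trans (sym e) e′)

  Linear⇒occ≡1 : ∀ {t} → Linear t → ∀ {i} → Occurs i t → occ i t ≡ 1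
  Linear⇒occ≡1 lin {i} h with Linear-occ lin i
  ... | inj₁ e = ⊥-elim (Occurs⇒occ≢0 h e)
  ... | inj₂ e = e

  occ≤1⇒Linear : ∀ t → (∀ i → occ i t ≤ 1) → Linear t
  occ≤1⇒Linear (var j) _ = var j
  occ≤1⇒Linear (a · b) occ≤1 =
    node (occ≤1⇒Linear a λ i → ℕₚ.≤-trans (ℕₚ.m≤m+n (occ i a) (occ i b)) (occ≤1 i))
         (occ≤1⇒Linear b λ i → ℕₚ.≤-trans (ℕₚ.m≤n+m (occ i b) (occ i a)) (occ≤1 i))
         disjoint
    where
    disjoint : Disjoint a b
    disjoint i a∋i b∋i with occ i a | Occurs⇒occ≢0 a∋i | occ i b | Occurs⇒occ≢0 b∋i | occ≤1 i
    ... | zero  | a≢0 | _     | _   | _           = a≢0 refl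
    ... | suc _ | _   | zero  | b≢0 | _           = b≢0 refl
    ... | suc m | _   | suc _ | _   | s≤s m+1+_≤0 = ℕₚ.1+n≢0 (ℕₚ.m+n≡0⇒n≡0 m (ℕₚ.n≤0⇒n≡0 m+1+_≤0))

  FullLinear⇒Linear : ∀ {t} → FullLinear t → Linear t
  FullLinear⇒Linear {t} full = occ≤1⇒Linear t (ℕₚ.≤-reflexive ∘ full)

  SameVars : Term n → Term n → Set
  SameVars t t′ = ∀ i → occ i t ≡ occ i t′

  ·-injective : ∀ {a b a′ b′ : Term n} → a · b ≡ a′ · b′ → a ≡ a′ × b ≡ b′
  ·-injective refl = refl , refl

  infix 4 _≟ₜ_
  _≟ₜ_ : DecidableEquality (Term n)
  var i ≟ₜ var j with i Finₚ.≟ j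
  ... | yes refl = yes refl
  ... | no  i≢j  = no λ { refl → i≢j refl }
  var _ ≟ₜ _ · _ = no λ ()
  _ · _ ≟ₜ var _ = no λ ()
  a · b ≟ₜ a′ · b′ with a ≟ₜ a′ | b ≟ₜ b′
  ... | yes refl | yes refl = yes refl
  ... | no  a≢a′ | _        = no λ { refl → a≢a′ refl }
  ... | yes _    | no  b≢b′ = no λ { refl → b≢b′ refl }

occ-fs-var-fs : ∀ {n} (i j : Fin n) → occ (fs i) (var (fs j)) ≡ occ i (var j)
occ-fs-var-fs i j = by-cases (i Finₚ.≟ j)
  where
  by-cases : Dec (i ≡ j) → occ (fs i) (var (fs j)) ≡ occ i (var j)
  by-cases (yes refl) = trans (occ-var-≡ (fs i)) (sym (occ-var-≡ i))
  by-cases (no i≢j)   = trans (occ-var-≢ (i≢j ∘ Finₚ.suc-injective)) (sym (occ-var-≢ i≢j))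

module _ {n : ℕ} where

  Colouring : Set
  Colouring = Fin n → Klein

  eval : Term n → Colouring → Klein
  eval (var i) c = c i
  eval (a · b) c = eval a c ⋈ eval b c

  leafSum : Term n → Colouring → Klein
  leafSum t c = ⨁ λ i → occ i t ⊙ c i

  leafSum-· : ∀ a b c → leafSum (a · b) c ≡ leafSum a c ⊕ leafSum b c
  leafSum-· a b c =
    trans (⨁-cong λ i → ⊙-+ (occ i a) (occ i b) (c i)) (⨁-⊕ (λ i → occ i a ⊙ c i) _)

  leafSum-var : ∀ j c → leafSum (var j) c ≡ c j
  leafSum-var j c = go j c
    where
    go : ∀ {m} (j : Fin m) (c : Fin m → Klein) → ⨁ (λ i → occ i (var j) ⊙ c i) ≡ c j
    go {suc m} fz c = trans
      (cong₂ _⊕_ (cong (_⊙ c fz) (occ-var-≡ {suc m} fz)) (⨁-𝟎 _ λ i → cong (_⊙ c (fs i)) (occ-var-≢ {i = fs i} {fz} λ ())))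
      (trans (⊕-identityʳ _) (⊕-identityʳ _))
    go (fs j) c = begin
      (occ fz (var (fs j)) ⊙ c fz) ⊕ ⨁ (λ i → occ (fs i) (var (fs j)) ⊙ c (fs i))
        ≡⟨ cong₂ _⊕_ (cong (_⊙ c fz) (occ-var-≢ {i = fz} {fs j} λ ()))
                     (⨁-cong λ i → cong (_⊙ c (fs i)) (occ-fs-var-fs i j)) ⟩
      ⨁ (λ i → occ i (var j) ⊙ c (fs i))
        ≡⟨ go j (c ∘ fs) ⟩
      c (fs j) ∎
      where open ≡-Reasoning

  eval≢𝟎⇒≡leafSum : ∀ t c → eval t c ≢ 𝟎 → eval t c ≡ leafSum t c
  eval≢𝟎⇒≡leafSum (var j) c _ = sym (leafSum-var j c)
  eval≢𝟎⇒≡leafSum (a · b) c h = begin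
    eval a c ⋈ eval b c         ≡⟨ ⋈≡⊕ d ⟩
    eval a c ⊕ eval b c         ≡⟨ cong₂ _⊕_ (eval≢𝟎⇒≡leafSum a c a≢𝟎) (eval≢𝟎⇒≡leafSum b c b≢𝟎) ⟩
    leafSum a c ⊕ leafSum b c   ≡⟨ sym (leafSum-· a b c) ⟩
    leafSum (a · b) c           ∎
    where
    open ≡-Reasoning
    d = ⋈≢𝟎⇒Distinct (eval a c) (eval b c) h
    a≢𝟎 = proj₁ d
    b≢𝟎 = proj₁ (proj₂ d)

  Agree : Term n → Colouring → Colouring → Set
  Agree t c c′ = ∀ i → Occurs i t → c i ≡ c′ i

  eval-cong : ∀ t {c c′} → Agree t c c′ → eval t c ≡ eval t c′
  eval-cong (var j) agr = agr j here
  eval-cong (a · b) agr = cong₂ _⋈_ (eval-cong a λ i → agr i ∘ left) (eval-cong b λ i → agr i ∘ right)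

  leafSum-cong : ∀ t {c c′} → Agree t c c′ → leafSum t c ≡ leafSum t c′
  leafSum-cong t {c} {c′} agr = ⨁-cong pointwise
    where
    pointwise : ∀ i → occ i t ⊙ c i ≡ occ i t ⊙ c′ i
    pointwise i with occ i t ℕ.≟ 0
    ... | yes t∌i = trans (cong (_⊙ c i) t∌i) (cong (_⊙ c′ i) (sym t∌i))
    ... | no  t∋i = cong (occ i t ⊙_) (agr i (occ≢0⇒Occurs t t∋i))

  merge : Term n → Colouring → Colouring → Colouring
  merge a c₁ c₂ i with occ i a
  ... | zero  = c₂ i
  ... | suc _ = c₁ i

  merge-agreeˡ : ∀ a c₁ c₂ → Agree a (merge a c₁ c₂) c₁
  merge-agreeˡ a c₁ c₂ i h with occ i a | Occurs⇒occ≢0 h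
  ... | zero  | a≢0 = ⊥-elim (a≢0 refl)
  ... | suc _ | _   = refl

  merge-agreeʳ : ∀ a b c₁ c₂ → Disjoint a b → Agree b (merge a c₁ c₂) c₂
  merge-agreeʳ a b c₁ c₂ disj i h with occ i a in eq
  ... | zero  = refl
  ... | suc _ = ⊥-elim (disj i (occ≢0⇒Occurs a λ e → ℕₚ.1+n≢0 (trans (sym eq) e)) h)

  eval-merge : ∀ a b c₁ c₂ → Disjoint a b → eval (a · b) (merge a c₁ c₂) ≡ eval a c₁ ⋈ eval b c₂
  eval-merge a b c₁ c₂ disj =
    cong₂ _⋈_ (eval-cong a (merge-agreeˡ a c₁ c₂)) (eval-cong b (merge-agreeʳ a b c₁ c₂ disj))

  eval-surjective : ∀ {u} → Linear u → ∀ {s} → s ≢ 𝟎 → ∃ λ c → eval u c ≡ s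
  eval-surjective (var j) {s} _ = (λ _ → s) , refl
  eval-surjective (node {a} {b} la lb disj) {s} s≢𝟎
    with eval-surjective la (proj₁ (proj₂ d)) | eval-surjective lb (proj₁ (proj₂ (Distinct-⊕ d)))
    where d = another-Distinct s≢𝟎
  ... | c₁ , e₁ | c₂ , e₂ =
    merge a c₁ c₂ , trans (eval-merge a b c₁ c₂ disj) (trans (cong₂ _⋈_ e₁ e₂) (⋈-split (another-Distinct s≢𝟎)))

-- Prescribing the value of a linear term together with its leaf sum over a set Y of variables

module Masked {n : ℕ} (Y : Fin n → Bool) where

  mask : Colouring → Colouring
  mask c i = if Y i then c i else 𝟎

  maskedSum : Term n → Colouring → Klein
  maskedSum u c = leafSum u (mask c)

  In Out : Term n → Set
  In  u = ∃ λ i → Occurs i u × Y i ≡ true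
  Out u = ∃ λ i → Occurs i u × Y i ≡ false

  In-·⁻ : ∀ a b → In (a · b) → In a ⊎ In b
  In-·⁻ a b (i , left  a∋i , yi) = inj₁ (i , a∋i , yi)
  In-·⁻ a b (i , right b∋i , yi) = inj₂ (i , b∋i , yi)

  Out-·⁻ : ∀ a b → Out (a · b) → Out a ⊎ Out b
  Out-·⁻ a b (i , left  a∋i , yi) = inj₁ (i , a∋i , yi)
  Out-·⁻ a b (i , right b∋i , yi) = inj₂ (i , b∋i , yi)

  data Kind (u : Term n) : Set where
    inside  : ¬ Out u → Kind u
    outside : ¬ In u → Kind u
    mixed   : In u → Out u → Kind u

  kind : ∀ u → Kind u
  kind u with Finₚ.any? (λ i → Occurs? i u ×-dec Y i Bool.≟ false)
            | Finₚ.any? (λ i → Occurs? i u ×-dec Y i Bool.≟ true)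
  ... | no ¬out  | _       = inside ¬out
  ... | yes _    | no ¬in  = outside ¬in
  ... | yes outu | yes inu = mixed inu outu

  mask-cong : ∀ t {c c′} → Agree t c c′ → Agree t (mask c) (mask c′)
  mask-cong t agr i t∋i = cong (if Y i then_else 𝟎) (agr i t∋i)

  mask-inside : ∀ u c → ¬ Out u → Agree u (mask c) c
  mask-inside u c ¬out i u∋i with Y i in yi
  ... | true  = refl
  ... | false = ⊥-elim (¬out (i , u∋i , yi))

  mask-outside : ∀ u c → ¬ In u → Agree u (mask c) (λ _ → 𝟎)
  mask-outside u c ¬in i u∋i with Y i in yi
  ... | true  = ⊥-elim (¬in (i , u∋i , yi))
  ... | false = refl

  Realises : Term n → Klein → Klein → Set
  Realises u s z = ∃ λ c → eval u c ≡ s × maskedSum u c ≡ z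

  realise-· : ∀ a b {s₁ s₂ z₁ z₂ s z} → Disjoint a b → s₁ ⋈ s₂ ≡ s → z₁ ⊕ z₂ ≡ z →
              Realises a s₁ z₁ → Realises b s₂ z₂ → Realises (a · b) s z
  realise-· a b disj s₁⋈s₂≡s z₁⊕z₂≡z (c₁ , e₁ , m₁) (c₂ , e₂ , m₂) =
    merge a c₁ c₂ ,
    trans (eval-merge a b c₁ c₂ disj) (trans (cong₂ _⋈_ e₁ e₂) s₁⋈s₂≡s) ,
    (begin
      leafSum (a · b) (mask (merge a c₁ c₂))
        ≡⟨ leafSum-· a b _ ⟩
      leafSum a (mask (merge a c₁ c₂)) ⊕ leafSum b (mask (merge a c₁ c₂))
        ≡⟨ cong₂ _⊕_ (leafSum-cong a (mask-cong a (merge-agreeˡ a c₁ c₂)))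
                     (leafSum-cong b (mask-cong b (merge-agreeʳ a b c₁ c₂ disj))) ⟩
      maskedSum a c₁ ⊕ maskedSum b c₂
        ≡⟨ trans (cong₂ _⊕_ m₁ m₂) z₁⊕z₂≡z ⟩
      _ ∎)
    where open ≡-Reasoning

  realise-inside : ∀ {u} → Linear u → ¬ Out u → ∀ {s} → s ≢ 𝟎 → Realises u s s
  realise-inside {u} lin ¬out {s} s≢𝟎 with eval-surjective lin s≢𝟎
  ... | c , e = c , e , (begin
    leafSum u (mask c)  ≡⟨ leafSum-cong u (mask-inside u c ¬out) ⟩
    leafSum u c         ≡⟨ sym (eval≢𝟎⇒≡leafSum u c λ e′ → s≢𝟎 (trans (sym e) e′)) ⟩
    eval u c            ≡⟨ e ⟩
    s                   ∎)
    where open ≡-Reasoning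

  realise-outside : ∀ {u} → Linear u → ¬ In u → ∀ {s} → s ≢ 𝟎 → Realises u s 𝟎
  realise-outside {u} lin ¬in s≢𝟎 with eval-surjective lin s≢𝟎
  ... | c , e = c , e ,
    trans (leafSum-cong u (mask-outside u c ¬in)) (⨁-𝟎 _ λ i → ⊙-𝟎 (occ i u))

  -- One factor is given the value y and the other s ⊕ y, whose ⋈-product is s, and the parts of the masked
  -- sum contributed by the two factors are chosen to add up to y.
  realise-mixed : ∀ {u} → Linear u → In u → Out u → ∀ {s y} → Distinct s y → Realises u s y
  realise-mixed (var j) (_ , here , yi) (_ , here , yi′) _ with () ← trans (sym yi) yi′
  realise-mixed (node {a} {b} la lb disj) inu outu {s} {y} d = by-kinds (kind a) (kind b)
    where
    y≢𝟎 = proj₁ (proj₂ d)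
    s⊕y≢𝟎 = proj₁ (proj₂ (Distinct-⊕ d))
    s⊕y⊕s≡y : (s ⊕ y) ⊕ s ≡ y
    s⊕y⊕s≡y = trans (⊕-comm (s ⊕ y) s) (⊕-cancelˡ s y)
    by-kinds : Kind a → Kind b → Realises (a · b) s y
    by-kinds (inside ¬outa) (inside ¬outb) with Out-·⁻ a b outu
    ... | inj₁ outa = ⊥-elim (¬outa outa)
    ... | inj₂ outb = ⊥-elim (¬outb outb)
    by-kinds (outside ¬ina) (outside ¬inb) with In-·⁻ a b inu
    ... | inj₁ ina = ⊥-elim (¬ina ina)
    ... | inj₂ inb = ⊥-elim (¬inb inb)
    by-kinds (inside ¬outa) (outside ¬inb) = realise-· a b disj (⋈-split d) (⊕-identityʳ y)
      (realise-inside la ¬outa y≢𝟎) (realise-outside lb ¬inb s⊕y≢𝟎)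
    by-kinds (inside ¬outa) (mixed inb outb) = realise-· a b disj (⋈-split′ d) s⊕y⊕s≡y
      (realise-inside la ¬outa s⊕y≢𝟎) (realise-mixed lb inb outb (Distinct-sym d))
    by-kinds (outside ¬ina) (inside ¬outb) = realise-· a b disj (⋈-split′ d) refl
      (realise-outside la ¬ina s⊕y≢𝟎) (realise-inside lb ¬outb y≢𝟎)
    by-kinds (outside ¬ina) (mixed inb outb) = realise-· a b disj (⋈-split d) refl
      (realise-outside la ¬ina y≢𝟎) (realise-mixed lb inb outb (Distinct-sym (Distinct-⊕ d)))
    by-kinds (mixed ina outa) (inside ¬outb) = realise-· a b disj (⋈-split d) (⊕-cancelˡ s y)
      (realise-mixed la ina outa (Distinct-sym d)) (realise-inside lb ¬outb s⊕y≢𝟎)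
    by-kinds (mixed ina outa) (outside ¬inb) = realise-· a b disj (⋈-split′ d) (⊕-identityʳ y)
      (realise-mixed la ina outa (Distinct-sym (Distinct-⊕ d))) (realise-outside lb ¬inb y≢𝟎)
    by-kinds (mixed ina outa) (mixed inb outb) = realise-· a b disj (⋈-split d) s⊕y⊕s≡y
      (realise-mixed la ina outa (Distinct-⊕ d)) (realise-mixed lb inb outb (Distinct-⊕ʳ d))

  realise-𝐤𝟎 : ∀ {a b} → Linear a → Linear b → Disjoint a b → In a → In b → Out a ⊎ Out b → Realises (a · b) 𝐤 𝟎
  realise-𝐤𝟎 {a} {b} la lb disj ina inb out = by-kinds (kind a) (kind b)
    where
    by-kinds : Kind a → Kind b → Realises (a · b) 𝐤 𝟎
    by-kinds (outside ¬ina) _ = ⊥-elim (¬ina ina)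
    by-kinds _ (outside ¬inb) = ⊥-elim (¬inb inb)
    by-kinds (inside ¬outa) (inside ¬outb) = ⊥-elim ([ ¬outa , ¬outb ] out)
    by-kinds (inside ¬outa) (mixed _ outb) = realise-· a b disj refl refl
      (realise-inside la ¬outa {𝐢} λ ()) (realise-mixed lb inb outb {𝐣} {𝐢} ((λ ()) , (λ ()) , (λ ())))
    by-kinds (mixed _ outa) (inside ¬outb) = realise-· a b disj refl refl
      (realise-mixed la ina outa {𝐢} {𝐣} ((λ ()) , (λ ()) , (λ ()))) (realise-inside lb ¬outb {𝐣} λ ())
    by-kinds (mixed _ outa) (mixed _ outb) = realise-· a b disj refl refl
      (realise-mixed la ina outa {𝐢} {𝐤} ((λ ()) , (λ ()) , (λ ()))) (realise-mixed lb inb outb {𝐣} {𝐤} ((λ ()) , (λ ()) , (λ ())))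

-- Canonical terms and their separation by colourings

module _ {n : ℕ} where

  leftmost : Term n → Fin n
  leftmost (var i) = i
  leftmost (a · b) = leftmost a

  Canonical : Term n → Set
  Canonical (var _) = ⊤
  Canonical (a · b) = Canonical a × Canonical b × toℕ (leftmost a) < toℕ (leftmost b)

  Occurs-leftmost : ∀ t → Occurs (leftmost t) t
  Occurs-leftmost (var i) = here
  Occurs-leftmost (a · b) = left (Occurs-leftmost a)

  leftmost-minimal : ∀ t → Canonical t → ∀ {i} → Occurs i t → toℕ (leftmost t) ≤ toℕ i
  leftmost-minimal (var j) _ here = ℕₚ.≤-refl
  leftmost-minimal (a · b) (ca , cb , a<b) (left a∋i)  = leftmost-minimal a ca a∋i
  leftmost-minimal (a · b) (ca , cb , a<b) (right b∋i) = ℕₚ.<⇒≤ (ℕₚ.<-≤-trans a<b (leftmost-minimal b cb b∋i))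

  Occurs-SameVars : ∀ (t t′ : Term n) → SameVars t t′ → ∀ {i} → Occurs i t → Occurs i t′
  Occurs-SameVars t t′ same {i} t∋i = occ≢0⇒Occurs t′ λ e → Occurs⇒occ≢0 t∋i (trans (same i) e)

  leftmost-SameVars : ∀ {t t′ : Term n} → Canonical t → Canonical t′ → SameVars t t′ → leftmost t ≡ leftmost t′
  leftmost-SameVars {t} {t′} ct ct′ same = Finₚ.toℕ-injective (ℕₚ.≤-antisym
    (leftmost-minimal t ct (Occurs-SameVars t′ t (λ i → sym (same i)) (Occurs-leftmost t′)))
    (leftmost-minimal t′ ct′ (Occurs-SameVars t t′ same (Occurs-leftmost t))))

  Separates : Term n → Term n → Set
  Separates t t′ = ∃ λ c → eval t c ≢ 𝟎 × eval t′ c ≡ 𝟎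

  varsOf : Term n → Fin n → Bool
  varsOf X i = does (Occurs? i X)

  maskedSum-varsOf : ∀ {t X} → Linear t → Linear X → (∀ {i} → Occurs i X → Occurs i t) →
                     ∀ c → Masked.maskedSum (varsOf X) t c ≡ leafSum X c
  maskedSum-varsOf {t} {X} lt lX X⊆t c = ⨁-cong pointwise
    where
    pointwise : ∀ i → occ i t ⊙ Masked.mask (varsOf X) c i ≡ occ i X ⊙ c i
    pointwise i with Linear-occ lX i
    ... | inj₁ occ≡0 = begin
      occ i t ⊙ Masked.mask (varsOf X) c i  ≡⟨ cong (λ b → occ i t ⊙ (if b then c i else 𝟎))
                                                    (dec-false (Occurs? i X) (λ h → Occurs⇒occ≢0 h occ≡0)) ⟩
      occ i t ⊙ 𝟎                           ≡⟨ ⊙-𝟎 (occ i t) ⟩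
      𝟎                                     ≡⟨ cong (_⊙ c i) (sym occ≡0) ⟩
      occ i X ⊙ c i                         ∎
      where open ≡-Reasoning
    ... | inj₂ occ≡1 = cong₂ _⊙_ (trans (Linear⇒occ≡1 lt (X⊆t X∋i)) (sym occ≡1))
                                 (cong (if_then c i else 𝟎) (dec-true (Occurs? i X) X∋i))
      where
      X∋i : Occurs i X
      X∋i = occ≢0⇒Occurs X λ e → ℕₚ.1+n≢0 (trans (sym occ≡1) e)

  -- A nonzero value of a linear term is its leaf sum, so a leaf sum of a · b that vanishes on the variables
  -- of X forces X to evaluate to 𝟎.
  vanishing : ∀ {a b X} → Linear a → Linear b → Disjoint a b → Linear X → (∀ {i} → Occurs i X → Occurs i (a · b)) →
              Masked.In (varsOf X) a → Masked.In (varsOf X) b → Masked.Out (varsOf X) a ⊎ Masked.Out (varsOf X) b →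
              ∃ λ c → eval (a · b) c ≢ 𝟎 × eval X c ≡ 𝟎
  vanishing {a} {b} {X} la lb disj lX X⊆ab ina inb out
    with Masked.realise-𝐤𝟎 (varsOf X) la lb disj ina inb out
  ... | c , value , sum = c , (λ e → 𝐤≢𝟎 (trans (sym value) e)) , X-vanishes
    where
    𝐤≢𝟎 : 𝐤 ≢ 𝟎
    𝐤≢𝟎 ()
    X-vanishes : eval X c ≡ 𝟎
    X-vanishes with eval X c ≟ₖ 𝟎
    ... | yes e = e
    ... | no X≢𝟎 = ⊥-elim (X≢𝟎 (begin
      eval X c                               ≡⟨ eval≢𝟎⇒≡leafSum X c X≢𝟎 ⟩
      leafSum X c                            ≡⟨ sym (maskedSum-varsOf (node la lb disj) lX X⊆ab c) ⟩
      Masked.maskedSum (varsOf X) (a · b) c  ≡⟨ sum ⟩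
      𝟎                                      ∎))
      where open ≡-Reasoning

  Separates-·ʳ : ∀ {a b b′} → Linear a → Disjoint a b → Disjoint a b′ → Separates b b′ → Separates (a · b) (a · b′)
  Separates-·ʳ {a} {b} {b′} la disj disj′ (c₂ , b≢𝟎 , b′≡𝟎)
    with eval-surjective la (proj₁ (proj₂ (another-Distinct b≢𝟎)))
  ... | c₁ , e₁ = merge a c₁ c₂ , nonzero , (begin
    eval (a · b′) (merge a c₁ c₂)  ≡⟨ eval-merge a b′ c₁ c₂ disj′ ⟩
    eval a c₁ ⋈ eval b′ c₂         ≡⟨ cong (eval a c₁ ⋈_) b′≡𝟎 ⟩
    eval a c₁ ⋈ 𝟎                  ≡⟨ ⋈-zeroʳ (eval a c₁) ⟩
    𝟎                              ∎)
    where
    open ≡-Reasoning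
    nonzero : eval (a · b) (merge a c₁ c₂) ≢ 𝟎
    nonzero e = Distinct⇒⋈≢𝟎 (Distinct-sym (another-Distinct b≢𝟎))
      (trans (cong (_⋈ eval b c₂) (sym e₁)) (trans (sym (eval-merge a b c₁ c₂ disj)) e))

  Separates-·ˡ : ∀ {a a′ b b′} → Linear b → Disjoint a b → (∀ {i} → Occurs i a′ → Occurs i a) →
                 Separates a a′ → Separates (a · b) (a′ · b′)
  Separates-·ˡ {a} {a′} {b} {b′} lb disj a′⊆a (c₁ , a≢𝟎 , a′≡𝟎)
    with eval-surjective lb (proj₁ (proj₂ (another-Distinct a≢𝟎)))
  ... | c₂ , e₂ = merge a c₁ c₂ , nonzero ,
    cong (_⋈ eval b′ (merge a c₁ c₂)) (trans (eval-cong a′ λ i a′∋i → merge-agreeˡ a c₁ c₂ i (a′⊆a a′∋i)) a′≡𝟎)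
    where
    nonzero : eval (a · b) (merge a c₁ c₂) ≢ 𝟎
    nonzero e = Distinct⇒⋈≢𝟎 (another-Distinct a≢𝟎)
      (trans (cong (eval a c₁ ⋈_) (sym e₂)) (trans (sym (eval-merge a b c₁ c₂ disj)) e))

  ·-SameVars-var : ∀ {a b x} → Disjoint a b → ¬ SameVars (a · b) (var x)
  ·-SameVars-var {a} {b} {x} disj same = disj (leftmost a) (Occurs-leftmost a)
    (subst (λ v → Occurs v b) (trans (lands-on (right (Occurs-leftmost b))) (sym (lands-on (left (Occurs-leftmost a)))))
           (Occurs-leftmost b))
    where
    lands-on : ∀ {i} → Occurs i (a · b) → i ≡ x
    lands-on = Occurs-var⇒≡ ∘ Occurs-SameVars (a · b) (var x) same

  module _ {a b a′ b′ : Term n} (la : Linear a) (lb : Linear b) (disj : Disjoint a b)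
           (la′ : Linear a′) (lb′ : Linear b′) (disj′ : Disjoint a′ b′)
           (same : SameVars (a · b) (a′ · b′)) {x₀ : Fin n} (a∋x₀ : Occurs x₀ a) (a′∋x₀ : Occurs x₀ a′) where

    private
      t⊆t′ : ∀ {i} → Occurs i (a · b) → Occurs i (a′ · b′)
      t⊆t′ = Occurs-SameVars (a · b) (a′ · b′) same

      t′⊆t : ∀ {i} → Occurs i (a′ · b′) → Occurs i (a · b)
      t′⊆t = Occurs-SameVars (a′ · b′) (a · b) (λ i → sym (same i))

    separate-a′⊈a : ∀ {i} → Occurs i a′ → ¬ Occurs i a → Separates (a · b) (a′ · b′)
    separate-a′⊈a {i} a′∋i a∌i with vanishing la lb disj la′ (t′⊆t ∘ left) ina inb out
      where
      ina = x₀ , a∋x₀ , dec-true (Occurs? x₀ a′) a′∋x₀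
      inb = i , Occurs-·-¬ˡ (t′⊆t (left a′∋i)) a∌i , dec-true (Occurs? i a′) a′∋i
      z = leftmost b′
      a′∌z = λ a′∋z → disj′ z a′∋z (Occurs-leftmost b′)
      out : Masked.Out (varsOf a′) a ⊎ Masked.Out (varsOf a′) b
      out with t′⊆t (right (Occurs-leftmost b′))
      ... | left  a∋z = inj₁ (z , a∋z , dec-false (Occurs? z a′) a′∌z)
      ... | right b∋z = inj₂ (z , b∋z , dec-false (Occurs? z a′) a′∌z)
    ... | c , t≢𝟎 , a′≡𝟎 = c , t≢𝟎 , cong (_⋈ eval b′ c) a′≡𝟎

    separate-a′⊂a : (∀ {i} → Occurs i a′ → Occurs i a) → ∀ {i} → Occurs i a → ¬ Occurs i a′ → Separates (a · b) (a′ · b′)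
    separate-a′⊂a a′⊆a {i} a∋i a′∌i with vanishing la lb disj lb′ (t′⊆t ∘ right) ina inb (inj₁ outa)
      where
      ina = i , a∋i , dec-true (Occurs? i b′) (Occurs-·-¬ˡ (t⊆t′ (left a∋i)) a′∌i)
      w = leftmost b
      a∌w = λ a∋w → disj w a∋w (Occurs-leftmost b)
      inb = w , Occurs-leftmost b , dec-true (Occurs? w b′) (Occurs-·-¬ˡ (t⊆t′ (right (Occurs-leftmost b))) (a∌w ∘ a′⊆a))
      outa = x₀ , a∋x₀ , dec-false (Occurs? x₀ b′) (disj′ x₀ a′∋x₀)
    ... | c , t≢𝟎 , b′≡𝟎 = c , t≢𝟎 , trans (cong (eval a′ c ⋈_) b′≡𝟎) (⋈-zeroʳ (eval a′ c))

  ¬⊈⇒⊆ : ∀ {a a′ : Term n} → ¬ (∃ λ i → Occurs i a′ × ¬ Occurs i a) → ∀ {i} → Occurs i a′ → Occurs i a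
  ¬⊈⇒⊆ {a} ¬a′⊈a {i} a′∋i with Occurs? i a
  ... | yes a∋i = a∋i
  ... | no  a∌i = ⊥-elim (¬a′⊈a (i , a′∋i , a∌i))

  leftmost-shared : ∀ a b a′ b′ → Canonical (a · b) → Canonical (a′ · b′) → SameVars (a · b) (a′ · b′) →
                    Occurs (leftmost a) a′
  leftmost-shared a b a′ b′ ct ct′ same =
    subst (λ v → Occurs v a′) (sym (leftmost-SameVars ct ct′ same)) (Occurs-leftmost a′)

  mismatch : ∀ {a a′} → Linear a → Linear a′ → (∀ {i} → Occurs i a′ → Occurs i a) →
             ¬ SameVars a a′ → ∃ λ i → Occurs i a × ¬ Occurs i a′
  mismatch {a} {a′} la la′ a′⊆a ¬same with Finₚ.¬∀⟶∃¬ n _ (λ i → occ i a ℕ.≟ occ i a′) ¬same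
  ... | i , occ≢ with Occurs? i a′
  ...   | yes a′∋i = ⊥-elim (occ≢ (trans (Linear⇒occ≡1 la (a′⊆a a′∋i)) (sym (Linear⇒occ≡1 la′ a′∋i))))
  ...   | no  a′∌i = i , occ≢0⇒Occurs a (λ e → occ≢ (trans e (sym (¬Occurs⇒occ≡0 a′ a′∌i)))) , a′∌i

  separate : ∀ {t t′} → Canonical t → Canonical t′ → Linear t → Linear t′ → SameVars t t′ → t ≢ t′ → Separates t t′
  separate {var x} {var x′} _ _ _ _ same t≢t′ with Occurs-var⇒≡ (Occurs-SameVars (var x) (var x′) same here)
  ... | refl = ⊥-elim (t≢t′ refl)
  separate {var x} {a′ · b′} _ _ _ (node _ _ disj′) same _ = ⊥-elim (·-SameVars-var disj′ (λ i → sym (same i)))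
  separate {a · b} {var x′} _ _ (node _ _ disj) _ same _ = ⊥-elim (·-SameVars-var disj same)
  separate {a · b} {a′ · b′} (ca , cb , _) (ca′ , cb′ , _) (node la lb disj) (node la′ lb′ disj′) same t≢t′
    with Finₚ.all? (λ i → occ i a ℕ.≟ occ i a′)
  ... | yes sameˡ with a ≟ₜ a′
  ...   | yes refl = Separates-·ʳ la disj disj′
                       (separate cb cb′ lb lb′ (λ i → ℕₚ.+-cancelˡ-≡ (occ i a) _ _ (same i)) (t≢t′ ∘ cong (a ·_)))
  ...   | no  a≢a′ = Separates-·ˡ {b′ = b′} lb disj (Occurs-SameVars a′ a (λ i → sym (sameˡ i)))
                       (separate ca ca′ la la′ sameˡ a≢a′)
  separate {a · b} {a′ · b′} ct ct′ (node la lb disj) (node la′ lb′ disj′) same t≢t′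
    | no ¬sameˡ with Finₚ.any? (λ i → Occurs? i a′ ×-dec ¬? (Occurs? i a))
  ... | yes (i , a′∋i , a∌i) =
    separate-a′⊈a la lb disj la′ lb′ disj′ same (Occurs-leftmost a) (leftmost-shared a b a′ b′ ct ct′ same) a′∋i a∌i
  ... | no ¬a′⊈a with mismatch la la′ (¬⊈⇒⊆ ¬a′⊈a) ¬sameˡ
  ...   | i , a∋i , a′∌i =
    separate-a′⊂a la lb disj la′ lb′ disj′ same (Occurs-leftmost a) (leftmost-shared a b a′ b′ ct ct′ same)
                  (¬⊈⇒⊆ ¬a′⊈a) a∋i a′∌i

  separate-FullLinear : ∀ {t t′} → Canonical t → Canonical t′ → FullLinear t → FullLinear t′ → t ≢ t′ → Separates t t′
  separate-FullLinear ct ct′ ft ft′ =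
    separate ct ct′ (FullLinear⇒Linear ft) (FullLinear⇒Linear ft′) (λ i → trans (ft i) (sym (ft′ i)))

module _ {n : ℕ} where

  infix 4 _≈ᶜ_
  data _≈ᶜ_ : Term n → Term n → Set where
    var  : ∀ i → var i ≈ᶜ var i
    keep : ∀ {a b a′ b′} → a ≈ᶜ a′ → b ≈ᶜ b′ → a · b ≈ᶜ a′ · b′
    swap : ∀ {a b a′ b′} → a ≈ᶜ a′ → b ≈ᶜ b′ → a · b ≈ᶜ b′ · a′

  ≈ᶜ⇒SameVars : ∀ {t t′} → t ≈ᶜ t′ → SameVars t t′
  ≈ᶜ⇒SameVars (var _)    i = refl
  ≈ᶜ⇒SameVars (keep p q) i = cong₂ _+_ (≈ᶜ⇒SameVars p i) (≈ᶜ⇒SameVars q i)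
  ≈ᶜ⇒SameVars (swap {a′ = a′} {b′ = b′} p q) i =
    trans (cong₂ _+_ (≈ᶜ⇒SameVars p i) (≈ᶜ⇒SameVars q i)) (ℕₚ.+-comm (occ i a′) (occ i b′))

  canonical-form : ∀ {t} → Linear t → ∃ λ t′ → Canonical t′ × t ≈ᶜ t′
  canonical-form (var i) = var i , tt , var i
  canonical-form (node {a} {b} la lb disj) with canonical-form la | canonical-form lb
  ... | a′ , ca′ , a≈a′ | b′ , cb′ , b≈b′ with ℕ.<-cmp (toℕ (leftmost a′)) (toℕ (leftmost b′))
  ...   | tri< a′<b′ _ _ = a′ · b′ , (ca′ , cb′ , a′<b′) , keep a≈a′ b≈b′
  ...   | tri> _ _ b′<a′ = b′ · a′ , (cb′ , ca′ , b′<a′) , swap a≈a′ b≈b′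
  ...   | tri≈ _ a′≡b′ _ = ⊥-elim (disj (leftmost a′) (back a≈a′ (Occurs-leftmost a′))
                              (subst (λ v → Occurs v b) (sym (Finₚ.toℕ-injective a′≡b′)) (back b≈b′ (Occurs-leftmost b′))))
    where
    back : ∀ {s s′} → s ≈ᶜ s′ → ∀ {i} → Occurs i s′ → Occurs i s
    back {s} {s′} p = Occurs-SameVars s′ s (λ i → sym (≈ᶜ⇒SameVars p i))

  orient : Fin 2 → Term n → Term n
  orient fz      t       = t
  orient (fs _) (var x) = var x
  orient (fs _) (a · b) = b · a

  occ-orient : ∀ s t i → occ i (orient s t) ≡ occ i t
  occ-orient fz     t       i = refl
  occ-orient (fs _) (var x) i = refl
  occ-orient (fs _) (a · b) i = ℕₚ.+-comm (occ i b) (occ i a)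

  eval-orient : ∀ s t c → eval (orient s t) c ≡ eval t c
  eval-orient fz     t       c = refl
  eval-orient (fs _) (var x) c = refl
  eval-orient (fs _) (a · b) c = ⋈-comm (eval b c) (eval a c)

flag : Bool → Fin 2
flag false = fz
flag true  = fs fz

¬FullLinear-var : ∀ {m} {x : Fin (suc (suc m))} → ¬ FullLinear (var x)
¬FullLinear-var {x = x} full with Occurs-var⇒≡ (occ≢0⇒Occurs (var x) (λ e → ℕₚ.1+n≢0 (trans (sym (full fz)) e)))
                                | Occurs-var⇒≡ (occ≢0⇒Occurs (var x) (λ e → ℕₚ.1+n≢0 (trans (sym (full (fs fz))) e)))
... | refl | ()

splitAt-injective : ∀ {m n} {k k′ : Fin (m + n)} → Fin.splitAt m k ≡ Fin.splitAt m k′ → k ≡ k′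
splitAt-injective {m} {n} {k} {k′} e =
  trans (sym (Finₚ.join-splitAt m n k)) (trans (cong (Fin.join m n) e) (Finₚ.join-splitAt m n k′))

cast-injective : ∀ {m n} .(eq : m ≡ n) {k k′ : Fin m} → Fin.cast eq k ≡ Fin.cast eq k′ → k ≡ k′
cast-injective eq {k} {k′} e =
  Finₚ.toℕ-injective (trans (sym (Finₚ.toℕ-cast eq k)) (trans (cong toℕ e) (Finₚ.toℕ-cast eq k′)))

remQuot-injective : ∀ k {m} {c c′ : Fin (k * m)} → Fin.remQuot {k} m c ≡ Fin.remQuot {k} m c′ → c ≡ c′
remQuot-injective k {m} {c} {c′} e =
  trans (sym (Finₚ.combine-remQuot {k} m c)) (trans (cong (uncurry Fin.combine) e) (Finₚ.combine-remQuot {k} m c′))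

record Enumeration {A : Set} (P : A → Set) (k : ℕ) : Set where
  field
    elem            : Fin k → A
    elem-P          : ∀ a → P (elem a)
    elem-injective  : ∀ a b → elem a ≡ elem b → a ≡ b
    elem-surjective : ∀ x → P x → ∃ λ a → elem a ≡ x

Enumeration-combine : ∀ {B : Set} {Q : B → Set} {k m} (f : Fin k → Fin m → B) → (∀ a i → Q (f a i)) →
                      (∀ a i a′ i′ → f a i ≡ f a′ i′ → a ≡ a′ × i ≡ i′) → (∀ y → Q y → ∃₂ λ a i → f a i ≡ y) →
                      Enumeration Q (k * m)
Enumeration-combine {k = k} {m} f Q-f f-injective f-surjective = record
  { elem            = λ c → f (proj₁ (split c)) (proj₂ (split c))
  ; elem-P          = λ c → Q-f (proj₁ (split c)) (proj₂ (split c))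
  ; elem-injective  = λ c c′ e → remQuot-injective k (uncurry (cong₂ _,_) (f-injective _ _ _ _ e))
  ; elem-surjective = surjective
  }
  where
  split : Fin (k * m) → Fin k × Fin m
  split = Fin.remQuot {k} m
  surjective : ∀ y → _ → ∃ λ c → f (proj₁ (split c)) (proj₂ (split c)) ≡ y
  surjective y qy with f-surjective y qy
  ... | a , i , e = Fin.combine a i , trans (cong (λ p → f (proj₁ p) (proj₂ p)) (Finₚ.remQuot-combine a i)) e

Enumeration-map : ∀ {A B : Set} {P : A → Set} {Q : B → Set} {k} → Enumeration P k → (f : A → B) →
                  (∀ {x} → P x → Q (f x)) → (∀ x x′ → f x ≡ f x′ → x ≡ x′) → (∀ y → Q y → ∃ λ x → P x × f x ≡ y) →
                  Enumeration Q k
Enumeration-map e f Q-f f-injective f-surjective = record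
  { elem            = f ∘ elem
  ; elem-P          = Q-f ∘ elem-P
  ; elem-injective  = λ a b → elem-injective a b ∘ f-injective (elem a) (elem b)
  ; elem-surjective = surjective
  }
  where
  open Enumeration e
  surjective : ∀ y → _ → ∃ λ a → f (elem a) ≡ y
  surjective y qy with f-surjective y qy
  ... | x , px , refl with elem-surjective x px
  ...   | a , refl = a , refl

Enumeration-⊎ : ∀ {A B C : Set} {P : A → Set} {Q : B → Set} {R : C → Set} {k m} → Enumeration P k → Enumeration Q m →
                (f : A → C) (g : B → C) → (∀ {x} → P x → R (f x)) → (∀ {y} → Q y → R (g y)) →
                (∀ x x′ → f x ≡ f x′ → x ≡ x′) → (∀ y y′ → g y ≡ g y′ → y ≡ y′) → (∀ x y → f x ≢ g y) →
                (∀ z → R z → (∃ λ x → P x × f x ≡ z) ⊎ (∃ λ y → Q y × g y ≡ z)) → Enumeration R (k + m)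
Enumeration-⊎ {R = R} {k = k} {m} eP eQ f g R-f R-g f-injective g-injective f≢g cover = record
  { elem            = elem
  ; elem-P          = λ c → R-elem (Fin.splitAt k c)
  ; elem-injective  = λ c c′ e → splitAt-injective (elem-injective′ (Fin.splitAt k c) (Fin.splitAt k c′) e)
  ; elem-surjective = surjective
  }
  where
  module P = Enumeration eP
  module Q = Enumeration eQ
  elem′ : Fin k ⊎ Fin m → _
  elem′ = [ f ∘ P.elem , g ∘ Q.elem ]
  elem : Fin (k + m) → _
  elem = elem′ ∘ Fin.splitAt k
  R-elem : ∀ c → R (elem′ c)
  R-elem (inj₁ a) = R-f (P.elem-P a)
  R-elem (inj₂ b) = R-g (Q.elem-P b)
  elem-injective′ : ∀ c c′ → elem′ c ≡ elem′ c′ → c ≡ c′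
  elem-injective′ (inj₁ a) (inj₁ a′) e = cong inj₁ (P.elem-injective a a′ (f-injective _ _ e))
  elem-injective′ (inj₂ b) (inj₂ b′) e = cong inj₂ (Q.elem-injective b b′ (g-injective _ _ e))
  elem-injective′ (inj₁ a) (inj₂ b)  e = ⊥-elim (f≢g _ _ e)
  elem-injective′ (inj₂ b) (inj₁ a)  e = ⊥-elim (f≢g _ _ (sym e))
  surjective : ∀ z → R z → ∃ λ c → elem c ≡ z
  surjective z rz with cover z rz
  ... | inj₁ (x , px , refl) with P.elem-surjective x px
  ...   | a , refl = a Fin.↑ˡ m , cong elem′ (Finₚ.splitAt-↑ˡ k a m)
  surjective z rz | inj₂ (y , qy , refl) with Q.elem-surjective y qy
  ...   | b , refl = k Fin.↑ʳ b , cong elem′ (Finₚ.splitAt-↑ʳ k m b)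

-- Grafting a new leaf onto a term

module _ {n : ℕ} where

  properSubterms : Term n → ℕ
  properSubterms (var _) = 0
  properSubterms (a · b) = suc (properSubterms a) + suc (properSubterms b)

  size : Term n → ℕ
  size t = suc (properSubterms t)

  -- graft x t k replaces the k-th subterm s of t, in preorder, by s · x.
  graft : Fin n → (t : Term n) → Fin (size t) → Term n
  graft x t       fz     = t · var x
  graft x (a · b) (fs k) = [ (λ k → graft x a k · b) , (λ k → a · graft x b k) ] (Fin.splitAt (size a) k)

  occ-graft : ∀ x t k i → occ i (graft x t k) ≡ occ i t + occ i (var x)
  occ-graft x t       fz     i = refl
  occ-graft x (a · b) (fs k) i with Fin.splitAt (size a) k
  ... | inj₁ k′ = begin
    occ i (graft x a k′) + occ i b      ≡⟨ cong (_+ occ i b) (occ-graft x a k′ i) ⟩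
    occ i a + occ i (var x) + occ i b   ≡⟨ ℕₚ.+-assoc (occ i a) _ _ ⟩
    occ i a + (occ i (var x) + occ i b) ≡⟨ cong (occ i a +_) (ℕₚ.+-comm (occ i (var x)) (occ i b)) ⟩
    occ i a + (occ i b + occ i (var x)) ≡⟨ ℕₚ.+-assoc (occ i a) _ _ ⟨
    occ i a + occ i b + occ i (var x)   ∎
    where open ≡-Reasoning
  ... | inj₂ k′ = trans (cong (occ i a +_) (occ-graft x b k′ i)) (sym (ℕₚ.+-assoc (occ i a) _ _))

  Occurs-graft : ∀ x t k → Occurs x (graft x t k)
  Occurs-graft x t k = occ≢0⇒Occurs (graft x t k) λ e →
    ℕₚ.1+n≢0 (trans (sym (occ-var-≡ x)) (ℕₚ.m+n≡0⇒n≡0 (occ x t) (trans (sym (occ-graft x t k x)) e)))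

  leftmost-graft : ∀ x t k → leftmost (graft x t k) ≡ leftmost t
  leftmost-graft x t       fz     = refl
  leftmost-graft x (a · b) (fs k) with Fin.splitAt (size a) k
  ... | inj₁ k′ = leftmost-graft x a k′
  ... | inj₂ k′ = refl

  size-graft : ∀ x t k → size (graft x t k) ≡ 2 + size t
  size-graft x t       fz     = cong suc (ℕₚ.+-comm (size t) 1)
  size-graft x (a · b) (fs k) with Fin.splitAt (size a) k
  ... | inj₁ k′ = cong (λ m → suc (m + size b)) (size-graft x a k′)
  ... | inj₂ k′ = cong suc (trans (cong (size a +_) (size-graft x b k′))
                                   (trans (ℕₚ.+-suc (size a) _) (cong suc (ℕₚ.+-suc (size a) _))))

  Canonical-graft : ∀ x t k → Canonical t → (∀ {i} → Occurs i t → toℕ i < toℕ x) → Canonical (graft x t k)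
  Canonical-graft x t       fz     ct below = ct , tt , below (Occurs-leftmost t)
  Canonical-graft x (a · b) (fs k) (ca , cb , a<b) below with Fin.splitAt (size a) k
  ... | inj₁ k′ = Canonical-graft x a k′ ca (below ∘ left) , cb ,
                  subst (λ v → toℕ v < toℕ (leftmost b)) (sym (leftmost-graft x a k′)) a<b
  ... | inj₂ k′ = ca , Canonical-graft x b k′ cb (below ∘ right) ,
                  subst (λ v → toℕ (leftmost a) < toℕ v) (sym (leftmost-graft x b k′)) a<b

  graft≢var : ∀ x t k y → graft x t k ≢ var y
  graft≢var x t       fz     y ()
  graft≢var x (a · b) (fs k) y with Fin.splitAt (size a) k
  ... | inj₁ _ = λ ()
  ... | inj₂ _ = λ ()

  ·var≢graft-fs : ∀ x s a b k → ¬ Occurs x (a · b) → s · var x ≢ graft x (a · b) (fs k)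
  ·var≢graft-fs x s a b k ab∌x e with Fin.splitAt (size a) k
  ... | inj₁ _ with refl ← e = ab∌x (right here)
  ... | inj₂ l = graft≢var x b l x (sym (proj₂ (·-injective e)))

  Positioned : Set
  Positioned = Σ (Term n) (Fin ∘ size)

  graft-injective : ∀ x t t′ k k′ → ¬ Occurs x t → ¬ Occurs x t′ → graft x t k ≡ graft x t′ k′ →
                    _≡_ {A = Positioned} (t , k) (t′ , k′)
  graft-injective x t       t′        fz     fz      _   _    refl = refl
  graft-injective x t       (a′ · b′) fz     (fs k′) _   t′∌x e    = ⊥-elim (·var≢graft-fs x t a′ b′ k′ t′∌x e)
  graft-injective x (a · b) t′        (fs k) fz      t∌x _    e    = ⊥-elim (·var≢graft-fs x t′ a b k t∌x (sym e))
  graft-injective x (a · b) (a′ · b′) (fs k) (fs k′) t∌x t′∌x e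
    with Fin.splitAt (size a) k in split | Fin.splitAt (size a′) k′ in split′
  ... | inj₁ l | inj₁ l′ with ·-injective e
  ...   | e₁ , refl with graft-injective x a a′ l l′ (t∌x ∘ left) (t′∌x ∘ left) e₁
  ...     | refl = cong (λ l → a · b , fs l) (splitAt-injective (trans split (sym split′)))
  graft-injective x (a · b) (a′ · b′) (fs k) (fs k′) t∌x t′∌x e
    | inj₂ l | inj₂ l′ with ·-injective e
  ...   | refl , e₂ with graft-injective x b b′ l l′ (t∌x ∘ right) (t′∌x ∘ right) e₂
  ...     | refl = cong (λ l → a · b , fs l) (splitAt-injective (trans split (sym split′)))
  graft-injective x (a · b) (a′ · b′) (fs k) (fs k′) t∌x t′∌x e
    | inj₁ l | inj₂ l′ = ⊥-elim (t∌x (right (subst (Occurs x) (sym (proj₂ (·-injective e))) (Occurs-graft x b′ l′))))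
  graft-injective x (a · b) (a′ · b′) (fs k) (fs k′) t∌x t′∌x e
    | inj₂ l | inj₁ l′ = ⊥-elim (t′∌x (right (subst (Occurs x) (proj₂ (·-injective e)) (Occurs-graft x b l))))

  graft-↑ˡ : ∀ x a b k → graft x (a · b) (fs (k Fin.↑ˡ size b)) ≡ graft x a k · b
  graft-↑ˡ x a b k rewrite Finₚ.splitAt-↑ˡ (size a) k (size b) = refl

  graft-↑ʳ : ∀ x a b k → graft x (a · b) (fs (size a Fin.↑ʳ k)) ≡ a · graft x b k
  graft-↑ʳ x a b k rewrite Finₚ.splitAt-↑ʳ (size a) (size b) k = refl

  Ungrafted : Fin n → Term n → Set
  Ungrafted x u = ∃₂ λ t k → Canonical t × graft x t k ≡ u

  ungraft : ∀ x u → Canonical u → Occurs x u → (∀ {i} → Occurs i u → toℕ i ≤ toℕ x) → u ≢ var x → Ungrafted x u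
  ungraft x (var y) _ here _ u≢x = ⊥-elim (u≢x refl)
  ungraft x (a · b) (ca , cb , a<b) u∋x below u≢x with b ≟ₜ var x
  ... | yes refl = a , fz , ca , refl
  ... | no b≢x with Occurs? x a
  ...   | yes a∋x = ungraftˡ (ungraft x a ca a∋x (below ∘ left) a≢x)
    where
    a≢x : a ≢ var x
    a≢x refl = ℕₚ.<-irrefl refl (ℕₚ.<-≤-trans a<b (below (right (Occurs-leftmost b))))
    ungraftˡ : Ungrafted x a → Ungrafted x (a · b)
    ungraftˡ (t , k , ct , e) = t · b , fs (k Fin.↑ˡ size b) ,
      (ct , cb , subst (λ v → toℕ v < toℕ (leftmost b)) (sym (trans (sym (leftmost-graft x t k)) (cong leftmost e))) a<b) ,
      trans (graft-↑ˡ x t b k) (cong (_· b) e)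
  ...   | no a∌x = ungraftʳ (ungraft x b cb (Occurs-·-¬ˡ u∋x a∌x) (below ∘ right) b≢x)
    where
    ungraftʳ : Ungrafted x b → Ungrafted x (a · b)
    ungraftʳ (t , k , ct , e) = a · t , fs (size a Fin.↑ʳ k) ,
      (ca , ct , subst (λ v → toℕ (leftmost a) < toℕ v) (sym (trans (sym (leftmost-graft x t k)) (cong leftmost e))) a<b) ,
      trans (graft-↑ʳ x a t k) (cong (a ·_) e)

oddFactorial : ℕ → ℕ
oddFactorial zero    = 1
oddFactorial (suc j) = oddFactorial j * suc (2 * j)

module _ {n : ℕ} where

  upTo : ℕ → Fin n → ℕ
  upTo j i = if does (toℕ i ℕ.≤? j) then 1 else 0

  upTo-≤ : ∀ {j i} → toℕ i ≤ j → upTo j i ≡ 1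
  upTo-≤ {j} {i} i≤j = cong (if_then 1 else 0) (dec-true (toℕ i ℕ.≤? j) i≤j)

  upTo-≰ : ∀ {j i} → ¬ toℕ i ≤ j → upTo j i ≡ 0
  upTo-≰ {j} {i} i≰j = cong (if_then 1 else 0) (dec-false (toℕ i ℕ.≤? j) i≰j)

  upTo-suc : ∀ j {x} i → toℕ x ≡ suc j → upTo j i + occ i (var x) ≡ upTo (suc j) i
  upTo-suc j {x} i x≡1+j = by-cases (toℕ i ℕ.≤? j) (i Finₚ.≟ x)
    where
    by-cases : Dec (toℕ i ≤ j) → Dec (i ≡ x) → upTo j i + occ i (var x) ≡ upTo (suc j) i
    by-cases (yes i≤j) (yes refl) = ⊥-elim (ℕₚ.<-irrefl x≡1+j (s≤s i≤j))
    by-cases (yes i≤j) (no  i≢x)  = trans (cong₂ _+_ (upTo-≤ i≤j) (occ-var-≢ i≢x)) (sym (upTo-≤ (ℕₚ.m≤n⇒m≤1+n i≤j)))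
    by-cases (no  i≰j) (yes refl) = trans (cong₂ _+_ (upTo-≰ i≰j) (occ-var-≡ i)) (sym (upTo-≤ (ℕₚ.≤-reflexive x≡1+j)))
    by-cases (no  i≰j) (no  i≢x)  = trans (cong₂ _+_ (upTo-≰ i≰j) (occ-var-≢ i≢x)) (sym (upTo-≰ i≰1+j))
      where
      i≰1+j : ¬ toℕ i ≤ suc j
      i≰1+j i≤1+j with ℕₚ.m≤n⇒m<n∨m≡n i≤1+j
      ... | inj₁ i<1+j = i≰j (ℕₚ.≤-pred i<1+j)
      ... | inj₂ i≡1+j = i≢x (Finₚ.toℕ-injective (trans i≡1+j (sym x≡1+j)))

  CanonicalOn : ℕ → Term n → Set
  CanonicalOn j t = Canonical t × (∀ i → occ i t ≡ upTo j i)

  CanonicalOn-Linear : ∀ {j t} → CanonicalOn j t → Linear t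
  CanonicalOn-Linear {j} {t} (_ , occ≡) = occ≤1⇒Linear t λ i → ℕₚ.≤-trans (ℕₚ.≤-reflexive (occ≡ i)) (upTo≤1 i)
    where
    upTo≤1 : ∀ i → upTo j i ≤ 1
    upTo≤1 i with does (toℕ i ℕ.≤? j)
    ... | true  = s≤s z≤n
    ... | false = z≤n

  CanonicalOn-Occurs : ∀ {j t} → CanonicalOn j t → ∀ {i} → Occurs i t → toℕ i ≤ j
  CanonicalOn-Occurs {j} {t} (_ , occ≡) {i} t∋i with toℕ i ℕ.≤? j
  ... | yes i≤j = i≤j
  ... | no  i≰j = ⊥-elim (Occurs⇒occ≢0 t∋i (trans (occ≡ i) (upTo-≰ i≰j)))

  Occurs-CanonicalOn : ∀ {j t} → CanonicalOn j t → ∀ {i} → toℕ i ≤ j → Occurs i t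
  Occurs-CanonicalOn {j} {t} (_ , occ≡) {i} i≤j =
    occ≢0⇒Occurs t λ e → ℕₚ.1+n≢0 (trans (sym (upTo-≤ i≤j)) (trans (sym (occ≡ i)) e))

  module _ {j} (j<n : suc j < n) where

    private
      x : Fin n
      x = Fin.fromℕ< j<n

      toℕx : toℕ x ≡ suc j
      toℕx = Finₚ.toℕ-fromℕ< j<n

    CanonicalOn-graft : ∀ {t} → CanonicalOn j t → ∀ k → CanonicalOn (suc j) (graft x t k)
    CanonicalOn-graft {t} ct@(canonical , occ≡) k =
      Canonical-graft x t k canonical (λ t∋i → subst (_ <_) (sym toℕx) (s≤s (CanonicalOn-Occurs ct t∋i))) ,
      λ i → trans (occ-graft x t k i) (trans (cong (_+ occ i (var x)) (occ≡ i)) (upTo-suc j i toℕx))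

    CanonicalOn-ungraft : ∀ {u} → CanonicalOn (suc j) u → ∃₂ λ t k → CanonicalOn j t × graft x t k ≡ u
    CanonicalOn-ungraft {u} cu@(canonical , occ≡) with ungraft x u canonical u∋x below u≢x
      where
      u∋x = Occurs-CanonicalOn cu (ℕₚ.≤-reflexive toℕx)
      below : ∀ {i} → Occurs i u → toℕ i ≤ toℕ x
      below u∋i = subst (_ ≤_) (sym toℕx) (CanonicalOn-Occurs cu u∋i)
      u≢x : u ≢ var x
      u≢x refl = ℕₚ.1+n≢0 (trans (sym toℕx) (trans (sym (cong toℕ x₀≡x)) (Finₚ.toℕ-fromℕ< 0<n)))
        where
        0<n = ℕₚ.<-trans (s≤s z≤n) j<n
        x₀≡x = Occurs-var⇒≡ (Occurs-CanonicalOn cu {Fin.fromℕ< 0<n} (subst (_≤ suc j) (sym (Finₚ.toℕ-fromℕ< 0<n)) z≤n))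
    ... | t , k , ct , refl = t , k , (ct , occ≡′) , refl
      where
      occ≡′ : ∀ i → occ i t ≡ upTo j i
      occ≡′ i = ℕₚ.+-cancelʳ-≡ (occ i (var x)) _ _
        (trans (sym (occ-graft x t k i)) (trans (occ≡ i) (sym (upTo-suc j i toℕx))))

module _ {m : ℕ} where

  CanonicalOn-zero : ∀ {t} → CanonicalOn {suc m} 0 t → t ≡ var fz
  CanonicalOn-zero {var y} ct = cong var (Finₚ.toℕ-injective (ℕₚ.n≤0⇒n≡0 (CanonicalOn-Occurs ct here)))
  CanonicalOn-zero {a · b} ct with CanonicalOn-Linear ct
  ... | node _ _ disj = ⊥-elim (disj fz (is-fz a left) (is-fz b right))
    where
    is-fz : ∀ s → (∀ {i} → Occurs i s → Occurs i (a · b)) → Occurs fz s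
    is-fz s s⊆t = subst (λ v → Occurs v s)
      (Finₚ.toℕ-injective (ℕₚ.n≤0⇒n≡0 (CanonicalOn-Occurs ct (s⊆t (Occurs-leftmost s))))) (Occurs-leftmost s)

  CanonicalOn-var-zero : CanonicalOn {suc m} 0 (var fz)
  CanonicalOn-var-zero = tt , occ≡
    where
    occ≡ : ∀ i → occ i (var fz) ≡ upTo 0 i
    occ≡ fz     = trans (occ-var-≡ {suc m} fz) (sym (upTo-≤ {suc m} {0} {fz} z≤n))
    occ≡ (fs i) = trans (occ-var-≢ {suc m} {fs i} {fz} λ ()) (sym (upTo-≰ {suc m} {0} {fs i} λ ()))

  CanonicalOn⇒FullLinear : ∀ {t} → CanonicalOn {suc m} m t → FullLinear t
  CanonicalOn⇒FullLinear (_ , occ≡) i = trans (occ≡ i) (upTo-≤ (Finₚ.toℕ≤pred[n] i))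

  FullLinear⇒CanonicalOn : ∀ {t} → Canonical t → FullLinear t → CanonicalOn {suc m} m t
  FullLinear⇒CanonicalOn ct full = ct , λ i → trans (full i) (sym (upTo-≤ (Finₚ.toℕ≤pred[n] i)))

  size-CanonicalOn : ∀ j → j ≤ m → ∀ {t} → CanonicalOn {suc m} j t → size t ≡ suc (2 * j)
  size-CanonicalOn zero    _   ct rewrite CanonicalOn-zero ct = refl
  size-CanonicalOn (suc j) j<m ct with CanonicalOn-ungraft (s≤s j<m) ct
  ... | t , k , ct′ , refl = begin
    size (graft _ t k)   ≡⟨ size-graft _ t k ⟩
    2 + size t           ≡⟨ cong (2 +_) (size-CanonicalOn j (ℕₚ.<⇒≤ j<m) ct′) ⟩
    suc (2 + 2 * j)      ≡⟨ cong suc (ℕₚ.*-suc 2 j) ⟨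
    suc (2 * suc j)      ∎
    where open ≡-Reasoning

  enumerate-CanonicalOn : ∀ j → j ≤ m → Enumeration (CanonicalOn {suc m} j) (oddFactorial j)
  enumerate-CanonicalOn zero _ = record
    { elem            = λ _ → var fz
    ; elem-P          = λ _ → CanonicalOn-var-zero
    ; elem-injective  = λ { fz fz _ → refl }
    ; elem-surjective = λ _ ct → fz , sym (CanonicalOn-zero ct)
    }
  enumerate-CanonicalOn (suc j) j<m = Enumeration-combine f f-P f-injective f-surjective
    where
    open Enumeration (enumerate-CanonicalOn j (ℕₚ.<⇒≤ j<m))
    x = Fin.fromℕ< (s≤s j<m)
    size-elem : ∀ b → size (elem b) ≡ suc (2 * j)
    size-elem b = size-CanonicalOn j (ℕₚ.<⇒≤ j<m) (elem-P b)
    f : Fin (oddFactorial j) → Fin (suc (2 * j)) → Term (suc m)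
    f b i = graft x (elem b) (Fin.cast (sym (size-elem b)) i)
    f-P : ∀ b i → CanonicalOn (suc j) (f b i)
    f-P b i = CanonicalOn-graft (s≤s j<m) (elem-P b) (Fin.cast (sym (size-elem b)) i)
    elem∌x : ∀ b → ¬ Occurs x (elem b)
    elem∌x b b∋x = ℕₚ.<-irrefl refl (subst (_≤ j) (Finₚ.toℕ-fromℕ< (s≤s j<m)) (CanonicalOn-Occurs (elem-P b) b∋x))
    f-injective : ∀ b i b′ i′ → f b i ≡ f b′ i′ → b ≡ b′ × i ≡ i′
    f-injective b i b′ i′ e
      with graft-injective x (elem b) (elem b′) (Fin.cast (sym (size-elem b)) i) (Fin.cast (sym (size-elem b′)) i′)
                           (elem∌x b) (elem∌x b′) e
    ... | e′ with elem-injective b b′ (cong proj₁ e′)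
    ...   | refl = refl , cast-injective (sym (size-elem b)) (,-injectiveʳ e′)
    f-surjective : ∀ u → CanonicalOn (suc j) u → ∃₂ λ b i → f b i ≡ u
    f-surjective u cu with CanonicalOn-ungraft (s≤s j<m) cu
    ... | t , k , ct , e with elem-surjective t ct
    ...   | b , refl = b , Fin.cast (size-elem b) k ,
      trans (cong (graft x (elem b)) (Finₚ.cast-involutive (sym (size-elem b)) (size-elem b) k)) e

data Tree : Set where
  leaf : Tree
  node : Tree → Tree → Tree

internal : Tree → ℕ
internal leaf       = 0
internal (node s t) = suc (internal s + internal t)

internalᵥ : ∀ {k} → Vec Tree k → ℕ
internalᵥ []       = 0
internalᵥ (t ∷ ts) = internal t + internalᵥ ts

-- forests k r counts the forests of k trees with r internal nodes in total: either the first tree is a leaf,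
-- or it is node s t with s, t the first two trees of a forest of k + 1 trees.
forests : ℕ → ℕ → ℕ
forests zero    zero    = 1
forests zero    (suc r) = 0
forests (suc k) zero    = forests k zero
forests (suc k) (suc r) = forests k (suc r) + forests (suc (suc k)) r

joinFirstTwo : ∀ {k} → Vec Tree (suc (suc k)) → Vec Tree (suc k)
joinFirstTwo (s ∷ t ∷ ts) = node s t ∷ ts

enumerate-forests : ∀ k r → Enumeration (λ (ts : Vec Tree k) → internalᵥ ts ≡ r) (forests k r)
enumerate-forests zero zero = record
  { elem = λ _ → [] ; elem-P = λ _ → refl ; elem-injective = λ { fz fz _ → refl } ; elem-surjective = λ { [] _ → fz , refl } }
enumerate-forests zero (suc r) = record
  { elem = λ () ; elem-P = λ () ; elem-injective = λ () ; elem-surjective = λ { [] () } }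
enumerate-forests (suc k) zero = Enumeration-map (enumerate-forests k zero) (leaf ∷_) id (λ _ _ → Vecₚ.∷-injectiveʳ) cover
  where
  cover : ∀ ts → internalᵥ ts ≡ 0 → ∃ λ ts′ → internalᵥ ts′ ≡ 0 × leaf ∷ ts′ ≡ ts
  cover (leaf ∷ ts) e = ts , e , refl
enumerate-forests (suc k) (suc r) = Enumeration-⊎ (enumerate-forests k (suc r)) (enumerate-forests (suc (suc k)) r)
  (leaf ∷_) joinFirstTwo id (λ {ts} e → trans (internal-joinFirstTwo ts) (cong suc e))
  (λ _ _ → Vecₚ.∷-injectiveʳ) joinFirstTwo-injective leaf∷≢joinFirstTwo cover
  where
  internal-joinFirstTwo : ∀ {k} (ts : Vec Tree (suc (suc k))) → internalᵥ (joinFirstTwo ts) ≡ suc (internalᵥ ts)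
  internal-joinFirstTwo (s ∷ t ∷ ts) = cong suc (ℕₚ.+-assoc (internal s) (internal t) (internalᵥ ts))
  joinFirstTwo-injective : ∀ ts ts′ → joinFirstTwo {k} ts ≡ joinFirstTwo ts′ → ts ≡ ts′
  joinFirstTwo-injective (s ∷ t ∷ ts) (.s ∷ .t ∷ .ts) refl = refl
  leaf∷≢joinFirstTwo : ∀ ts ts′ → leaf ∷ ts ≢ joinFirstTwo {k} ts′
  leaf∷≢joinFirstTwo _ (_ ∷ _ ∷ _) ()
  cover : ∀ ts → internalᵥ ts ≡ suc r →
          (∃ λ ts′ → internalᵥ ts′ ≡ suc r × leaf ∷ ts′ ≡ ts) ⊎ (∃ λ ts′ → internalᵥ ts′ ≡ r × joinFirstTwo ts′ ≡ ts)
  cover (leaf ∷ ts)       e = inj₁ (ts , e , refl)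
  cover (node s t ∷ ts) e = inj₂ (s ∷ t ∷ ts , ℕₚ.suc-injective (trans (sym (internal-joinFirstTwo (s ∷ t ∷ ts))) e) , refl)

enumerate-trees : ∀ r → Enumeration (λ t → internal t ≡ r) (forests 1 r)
enumerate-trees r = Enumeration-map (enumerate-forests 1 r) Vec.head (λ {ts} → internal-head ts) head-injective cover
  where
  internal-head : ∀ (ts : Vec Tree 1) → internalᵥ ts ≡ r → internal (Vec.head ts) ≡ r
  internal-head (t ∷ []) e = trans (sym (ℕₚ.+-identityʳ (internal t))) e
  head-injective : ∀ (ts ts′ : Vec Tree 1) → Vec.head ts ≡ Vec.head ts′ → ts ≡ ts′
  head-injective (t ∷ []) (.t ∷ []) refl = refl
  cover : ∀ t → internal t ≡ r → ∃ λ ts → internalᵥ ts ≡ r × Vec.head ts ≡ t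
  cover t e = t ∷ [] , trans (ℕₚ.+-identityʳ (internal t)) e , refl

module _ {n : ℕ} where

  shape : Term n → Tree
  shape (var _) = leaf
  shape (a · b) = node (shape a) (shape b)

  leafCount : Tree → ℕ
  leafCount t = suc (internal t)

  length-leaves : ∀ t → List.length (leaves t) ≡ leafCount (shape t)
  length-leaves (var _) = refl
  length-leaves (a · b) = begin
    List.length (leaves a List.++ leaves b)               ≡⟨ Listₚ.length-++ (leaves a) ⟩
    List.length (leaves a) + List.length (leaves b)       ≡⟨ cong₂ _+_ (length-leaves a) (length-leaves b) ⟩
    suc (internal (shape a)) + suc (internal (shape b))   ≡⟨ cong suc (ℕₚ.+-suc (internal (shape a)) _) ⟩
    leafCount (shape (a · b))                             ∎
    where open ≡-Reasoning

  shape-leaves-injective : ∀ t t′ {r r′} → shape t ≡ shape t′ → leaves t List.++ r ≡ leaves t′ List.++ r′ → t ≡ t′ × r ≡ r′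
  shape-leaves-injective (var x) (var x′) _ refl = refl , refl
  shape-leaves-injective (a · b) (a′ · b′) {r} {r′} e l
    with shape-leaves-injective a a′ (cong left-subtree e)
           (trans (sym (Listₚ.++-assoc (leaves a) (leaves b) r)) (trans l (Listₚ.++-assoc (leaves a′) (leaves b′) r′)))
    where
    left-subtree : Tree → Tree
    left-subtree leaf       = leaf
    left-subtree (node s _) = s
  ... | refl , l′ with shape-leaves-injective b b′ (cong right-subtree e) l′
    where
    right-subtree : Tree → Tree
    right-subtree leaf       = leaf
    right-subtree (node _ t) = t
  ...   | refl , refl = refl , refl

  shape-leaves-surjective : ∀ s l → leafCount s ≤ List.length l → ∃₂ λ t r → shape t ≡ s × leaves t List.++ r ≡ l
  shape-leaves-surjective leaf List.[]         ()
  shape-leaves-surjective leaf (x List.∷ l) _ = var x , l , refl , refl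
  shape-leaves-surjective (node s₁ s₂) l s≤l
    with shape-leaves-surjective s₁ l (ℕₚ.≤-trans (ℕₚ.m≤m+n (leafCount s₁) (internal s₂)) (ℕₚ.≤-trans (ℕₚ.n≤1+n _) s≤l))
  ... | t₁ , r₁ , refl , l₁ with shape-leaves-surjective s₂ r₁ s₂≤r₁
    where
    s₂≤r₁ : leafCount s₂ ≤ List.length r₁
    s₂≤r₁ = ℕₚ.+-cancelˡ-≤ (leafCount s₁) _ _ (begin
      leafCount s₁ + leafCount s₂                    ≡⟨ ℕₚ.+-suc (leafCount s₁) (internal s₂) ⟩
      leafCount (node s₁ s₂)                         ≤⟨ s≤l ⟩
      List.length l                                  ≡⟨ cong List.length l₁ ⟨
      List.length (leaves t₁ List.++ r₁)            ≡⟨ Listₚ.length-++ (leaves t₁) ⟩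
      List.length (leaves t₁) + List.length r₁      ≡⟨ cong (_+ List.length r₁) (length-leaves t₁) ⟩
      leafCount s₁ + List.length r₁                  ∎)
      where open ℕₚ.≤-Reasoning
  ... | t₂ , r₂ , refl , l₂ = t₁ · t₂ , r₂ , refl ,
    trans (Listₚ.++-assoc (leaves t₁) (leaves t₂) r₂) (trans (cong (leaves t₁ List.++_) l₂) l₁)

  count : Fin n → List (Fin n) → ℕ
  count i = sum ∘ List.map (λ x → occ i (var x))

  occ≡count : ∀ i t → occ i t ≡ count i (leaves t)
  occ≡count i (var x) = sym (ℕₚ.+-identityʳ _)
  occ≡count i (a · b) = trans (cong₂ _+_ (occ≡count i a) (occ≡count i b)) (sym (begin
    sum (List.map f (leaves a List.++ leaves b))               ≡⟨ cong sum (Listₚ.map-++ f (leaves a) (leaves b)) ⟩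
    sum (List.map f (leaves a) List.++ List.map f (leaves b))  ≡⟨ sum-++ (List.map f (leaves a)) _ ⟩
    count i (leaves a) + count i (leaves b)                         ∎))
    where
    open ≡-Reasoning
    f = λ x → occ i (var x)

  Sorted : List (Fin n) → Set
  Sorted = AllPairs Fin._<_

  leaves-leftmost : ∀ (t : Term n) → ∃ λ rest → leaves t ≡ leftmost t List.∷ rest
  leaves-leftmost (var x) = List.[] , refl
  leaves-leftmost (a · b) with leaves-leftmost a
  ... | rest , e = rest List.++ leaves b , cong (List._++ leaves b) e

  AllPairs-++⁻ʳ : ∀ {R : Fin n → Fin n → Set} xs {ys} → AllPairs R (xs List.++ ys) → AllPairs R ys
  AllPairs-++⁻ʳ List.[]         rs       = rs
  AllPairs-++⁻ʳ (x List.∷ xs) (_ ∷ rs) = AllPairs-++⁻ʳ xs rs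

  Sorted⇒Canonical : ∀ (t : Term n) r → Sorted (leaves t List.++ r) → Canonical t
  Sorted⇒Canonical (var x) r _ = tt
  Sorted⇒Canonical (a · b) r sorted rewrite Listₚ.++-assoc (leaves a) (leaves b) r =
    Sorted⇒Canonical a (leaves b List.++ r) sorted ,
    Sorted⇒Canonical b r (AllPairs-++⁻ʳ (leaves a) sorted) ,
    a<b
    where
    a<b : toℕ (leftmost a) < toℕ (leftmost b)
    a<b = heads< (leaves-leftmost a) (leaves-leftmost b)
      where
      heads< : (∃ λ ra → leaves a ≡ leftmost a List.∷ ra) → (∃ λ rb → leaves b ≡ leftmost b List.∷ rb) →
               toℕ (leftmost a) < toℕ (leftmost b)
      heads< (ra , ea) (rb , eb) with subst (λ l → Sorted (l List.++ leaves b List.++ r)) ea sorted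
      ... | first ∷ _ with subst (λ l → All (leftmost a Fin.<_) (l List.++ r)) eb (Allₚ.++⁻ʳ ra first)
      ...   | a<b ∷ _ = a<b

count-allFin : ∀ {n} (i : Fin n) → count i (List.allFin n) ≡ 1
count-allFin {n} i = trans (cong sum (Listₚ.map-tabulate id (λ x → occ i (var x)))) (Σ-δ i)
  where
  sum-zeros : ∀ {m} (f : Fin m → ℕ) → (∀ j → f j ≡ 0) → sum (List.tabulate f) ≡ 0
  sum-zeros {zero}  f f≡0 = refl
  sum-zeros {suc m} f f≡0 = cong₂ _+_ (f≡0 fz) (sum-zeros (f ∘ fs) (f≡0 ∘ fs))
  Σ-δ : ∀ {m} (i : Fin m) → sum (List.tabulate (λ j → occ i (var j))) ≡ 1
  Σ-δ {suc m} fz     = cong₂ _+_ (occ-var-≡ {suc m} fz) (sum-zeros _ λ j → occ-var-≢ {suc m} {fz} {fs j} λ ())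
  Σ-δ {suc m} (fs i) = cong₂ _+_ (occ-var-≢ {suc m} {fs i} {fz} λ ())
                                 (trans (cong sum (Listₚ.tabulate-cong λ j → occ-fs-var-fs i j)) (Σ-δ i))

Sorted-allFin : ∀ n → Sorted (List.allFin n)
Sorted-allFin n = AllPairsₚ.tabulate⁺-< id

module _ {n : ℕ} where

  leaves≡allFin⇒Bracketing : ∀ {t : Term n} → leaves t ≡ List.allFin n → Bracketing t
  leaves≡allFin⇒Bracketing {t} e = (λ i → trans (occ≡count i t) (trans (cong (count i) e) (count-allFin i))) , e

  Bracketing⇒Canonical : ∀ {t : Term n} → Bracketing t → Canonical t
  Bracketing⇒Canonical {t} (_ , e) =
    Sorted⇒Canonical t List.[] (subst Sorted (sym (trans (Listₚ.++-identityʳ (leaves t)) e)) (Sorted-allFin n))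

module _ {m : ℕ} where

  private
    length-allFin : List.length (List.allFin (suc m)) ≡ suc m
    length-allFin = Listₚ.length-tabulate id

  bracket : ∀ s → internal s ≡ m → ∃₂ λ (t : Term (suc m)) r → shape t ≡ s × leaves t List.++ r ≡ List.allFin (suc m)
  bracket s e = shape-leaves-surjective s (List.allFin (suc m)) (ℕₚ.≤-reflexive (trans (cong suc e) (sym length-allFin)))

  bracket-leaves : ∀ {s} (e : internal s ≡ m) → leaves (proj₁ (bracket s e)) ≡ List.allFin (suc m)
  bracket-leaves {s} e with bracket s e
  ... | t , r , refl , l = trans (sym (Listₚ.++-identityʳ (leaves t))) (trans (cong (leaves t List.++_) (sym r≡[])) l)
    where
    r≡[] : r ≡ List.[]
    r≡[] = length≡0 r (ℕₚ.+-cancelˡ-≡ (suc m) _ _ (begin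
      suc m + List.length r                   ≡⟨ cong (_+ List.length r) (trans (cong suc (sym e)) (sym (length-leaves t))) ⟩
      List.length (leaves t) + List.length r  ≡⟨ Listₚ.length-++ (leaves t) ⟨
      List.length (leaves t List.++ r)        ≡⟨ cong List.length l ⟩
      List.length (List.allFin (suc m))       ≡⟨ trans length-allFin (sym (ℕₚ.+-identityʳ (suc m))) ⟩
      suc m + 0                               ∎))
      where
      open ≡-Reasoning
      length≡0 : ∀ (xs : List (Fin (suc m))) → List.length xs ≡ 0 → xs ≡ List.[]
      length≡0 List.[] _ = refl

  enumerate-bracketings : Enumeration (Bracketing {suc m}) (forests 1 m)
  enumerate-bracketings = record
    { elem            = elem
    ; elem-P          = λ a → leaves≡allFin⇒Bracketing {t = elem a} (bracket-leaves (T.elem-P a))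
    ; elem-injective  = λ a b e → T.elem-injective a b (trans (sym (shape-elem a)) (trans (cong shape e) (shape-elem b)))
    ; elem-surjective = surjective
    }
    where
    module T = Enumeration (enumerate-trees m)
    elem : Fin (forests 1 m) → Term (suc m)
    elem a = proj₁ (bracket (T.elem a) (T.elem-P a))
    shape-elem : ∀ a → shape (elem a) ≡ T.elem a
    shape-elem a = proj₁ (proj₂ (proj₂ (bracket (T.elem a) (T.elem-P a))))
    surjective : ∀ t → Bracketing t → ∃ λ a → elem a ≡ t
    surjective t (_ , lt) with T.elem-surjective (shape t) internal≡m
      where
      internal≡m : internal (shape t) ≡ m
      internal≡m = ℕₚ.suc-injective (trans (sym (length-leaves t)) (trans (cong List.length lt) length-allFin))
    ... | a , ea = a , proj₁ (shape-leaves-injective (elem a) t (trans (shape-elem a) ea)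
                     (trans (Listₚ.++-identityʳ (leaves (elem a)))
                       (trans (bracket-leaves (T.elem-P a)) (sym (trans (Listₚ.++-identityʳ (leaves t)) lt)))))

double-factorial : ∀ j → (2 * j) ! ≡ oddFactorial j * (2 ^ j * j !)
double-factorial zero    = refl
double-factorial (suc j) = begin
  (2 * suc j) !                                                  ≡⟨ cong _! (two-suc j) ⟩
  suc (suc (2 * j)) * (suc (2 * j) * (2 * j) !)
    ≡⟨ cong (λ x → suc (suc (2 * j)) * (suc (2 * j) * x)) (double-factorial j) ⟩
  suc (suc (2 * j)) * (suc (2 * j) * (oddFactorial j * (2 ^ j * j !)))  ≡⟨ rearrange j (oddFactorial j) (2 ^ j) (j !) ⟩
  oddFactorial j * suc (2 * j) * (2 * 2 ^ j * (suc j * j !))     ∎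
  where
  open ≡-Reasoning
  two-suc : ∀ j → 2 * suc j ≡ suc (suc (2 * j))
  two-suc = solve-∀
  rearrange : ∀ j d p f → suc (suc (2 * j)) * (suc (2 * j) * (d * (p * f))) ≡ d * suc (2 * j) * (2 * p * (suc j * f))
  rearrange = solve-∀

DoubleFact≡oddFactorial : ∀ j → DoubleFact j ≡ oddFactorial j
DoubleFact≡oddFactorial j =
  trans (cong (λ x → (x / (2 ^ j * j !)) {{2^j*j!≢0}}) (double-factorial j))
        (m*n/n≡m (oddFactorial j) (2 ^ j * j !) {{2^j*j!≢0}})
  where
  2^j*j!≢0 : NonZero (2 ^ j * j !)
  2^j*j!≢0 = ℕₚ.m*n≢0 (2 ^ j) (j !) {{ℕₚ.m^n≢0 2 j}} {{j ℕₚ.!≢0}}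

binom : ℕ → ℕ → ℕ
binom n       zero    = 1
binom zero    (suc k) = 0
binom (suc n) (suc k) = binom n k + binom n (suc k)

binom≡C : ∀ n k → binom n k ≡ n C k
binom≡C n       zero    = refl
binom≡C zero    (suc k) = refl
binom≡C (suc n) (suc k) = trans (cong₂ _+_ (binom≡C n k) (binom≡C n (suc k))) (nCk+nC[k+1]≡[n+1]C[k+1] n k)

binom-sym : ∀ a b → binom (a + b) a ≡ binom (a + b) b
binom-sym a b = begin
  binom (a + b) a          ≡⟨ binom≡C (a + b) a ⟩
  (a + b) C a              ≡⟨ nCk≡nC[n∸k] (ℕₚ.m≤m+n a b) ⟩
  (a + b) C (a + b ∸ a)    ≡⟨ cong ((a + b) C_) (ℕₚ.m+n∸m≡n a b) ⟩
  (a + b) C b              ≡⟨ binom≡C (a + b) b ⟨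
  binom (a + b) b          ∎
  where open ≡-Reasoning

binom-absorption : ∀ n k → suc k * binom n (suc k) + k * binom n k ≡ n * binom n k
binom-absorption zero    zero    = refl
binom-absorption zero    (suc k) = cong₂ _+_ (ℕₚ.*-zeroʳ (suc (suc k))) (ℕₚ.*-zeroʳ (suc k))
binom-absorption (suc n) zero    = begin
  1 * (1 + binom n 1) + 0  ≡⟨ rearrange (binom n 1) ⟩
  1 + (1 * binom n 1 + 0)  ≡⟨ cong (1 +_) (binom-absorption n 0) ⟩
  1 + n * 1                ≡⟨⟩
  suc n * 1                ∎
  where
  open ≡-Reasoning
  rearrange : ∀ x → 1 * (1 + x) + 0 ≡ 1 + (1 * x + 0)
  rearrange = solve-∀
binom-absorption (suc n) (suc k) = begin
  suc (suc k) * (b₁ + b₂) + suc k * (b₀ + b₁)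
    ≡⟨ regroup k b₀ b₁ b₂ ⟩
  (suc (suc k) * b₂ + suc k * b₁) + (suc k * b₁ + k * b₀) + b₀ + b₁
    ≡⟨ cong₂ (λ x y → x + y + b₀ + b₁) (binom-absorption n (suc k)) (binom-absorption n k) ⟩
  n * b₁ + n * b₀ + b₀ + b₁
    ≡⟨ collect n b₀ b₁ ⟩
  suc n * (b₀ + b₁) ∎
  where
  open ≡-Reasoning
  b₀ = binom n k
  b₁ = binom n (suc k)
  b₂ = binom n (suc (suc k))
  regroup : ∀ k b₀ b₁ b₂ → suc (suc k) * (b₁ + b₂) + suc k * (b₀ + b₁) ≡
                           (suc (suc k) * b₂ + suc k * b₁) + (suc k * b₁ + k * b₀) + b₀ + b₁
  regroup = solve-∀
  collect : ∀ n b₀ b₁ → n * b₁ + n * b₀ + b₀ + b₁ ≡ suc n * (b₀ + b₁)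
  collect = solve-∀

-- binom₋₁ n r is n choose r − 1, read as 0 for r = 0.
binom₋₁ : ℕ → ℕ → ℕ
binom₋₁ n zero    = 0
binom₋₁ n (suc r) = binom n r

pascal₋₁ : ∀ n r → binom (suc n) r ≡ binom₋₁ n r + binom n r
pascal₋₁ n zero    = refl
pascal₋₁ n (suc r) = refl

forests-0 : ∀ k → forests k 0 ≡ 1
forests-0 zero    = refl
forests-0 (suc k) = forests-0 k

-- The ballot formula forests (k + 1) r = binom (2r + k) r − binom (2r + k) (r − 1), stated without subtraction.
forests-ballot : ∀ r k → forests (suc k) r + binom₋₁ (r + r + k) r ≡ binom (r + r + k) r
forests-ballot zero          k = trans (ℕₚ.+-identityʳ _) (forests-0 (suc k))
forests-ballot (suc zero)    zero = refl
forests-ballot (suc (suc r)) zero = begin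
  forests 2 (suc r) + binom (suc (suc r) + suc (suc r) + 0) (suc r)
    ≡⟨ cong (λ x → forests 2 (suc r) + binom x (suc r)) (sizes r) ⟩
  forests 2 (suc r) + binom (suc N) (suc r)          ≡⟨ ℕₚ.+-assoc (forests 2 (suc r)) _ _ ⟨
  forests 2 (suc r) + binom N r + binom N (suc r)
    ≡⟨ cong (_+ binom N (suc r))
            (subst (λ x → forests 2 (suc r) + binom₋₁ x (suc r) ≡ binom x (suc r)) (sizes′ r) (forests-ballot (suc r) 1)) ⟩
  binom N (suc r) + binom N (suc r)                  ≡⟨ cong (binom N (suc r) +_) (binom-sym (suc r) (suc (suc r))) ⟩
  binom (suc N) (suc (suc r))                        ≡⟨ cong (λ x → binom x (suc (suc r))) (sizes r) ⟨
  binom (suc (suc r) + suc (suc r) + 0) (suc (suc r)) ∎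
  where
  open ≡-Reasoning
  N = suc r + suc (suc r)
  sizes : ∀ r → suc (suc r) + suc (suc r) + 0 ≡ suc (suc r + suc (suc r))
  sizes = solve-∀
  sizes′ : ∀ r → suc r + suc r + 1 ≡ suc r + suc (suc r)
  sizes′ = solve-∀
forests-ballot (suc r) (suc k) = begin
  (X + Y) + binom (suc r + suc r + suc k) r        ≡⟨ cong (λ x → (X + Y) + binom x r) (sizes r k) ⟩
  (X + Y) + binom (suc N) r                        ≡⟨ cong ((X + Y) +_) (pascal₋₁ N r) ⟩
  (X + Y) + (binom₋₁ N r + binom N r)              ≡⟨ regroup X Y (binom₋₁ N r) (binom N r) ⟩
  (X + binom N r) + (Y + binom₋₁ N r)
    ≡⟨ cong₂ _+_ (forests-ballot (suc r) k)
                 (subst (λ x → Y + binom₋₁ x r ≡ binom x r) (sizes′ r k) (forests-ballot r (suc (suc k)))) ⟩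
  binom N (suc r) + binom N r                      ≡⟨ ℕₚ.+-comm (binom N (suc r)) _ ⟩
  binom (suc N) (suc r)                            ≡⟨ cong (λ x → binom x (suc r)) (sizes r k) ⟨
  binom (suc r + suc r + suc k) (suc r)            ∎
  where
  open ≡-Reasoning
  N = suc r + suc r + k
  X = forests (suc k) (suc r)
  Y = forests (suc (suc (suc k))) r
  sizes : ∀ r k → suc r + suc r + suc k ≡ suc (suc r + suc r + k)
  sizes = solve-∀
  sizes′ : ∀ r k → r + r + suc (suc k) ≡ suc r + suc r + k
  sizes′ = solve-∀
  regroup : ∀ a b c d → (a + b) + (c + d) ≡ (a + d) + (b + c)
  regroup = solve-∀

Catalan≡forests : ∀ m → Catalan m ≡ forests 1 m
Catalan≡forests zero    = refl
Catalan≡forests (suc r) = trans (cong (_/ suc m) central) (m*n/n≡m (forests 1 m) (suc m))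
  where
  open ≡-Reasoning
  m = suc r
  b = binom (m + m + 0) m
  b₋₁ = binom₋₁ (m + m + 0) m
  b₋₁-sym : b₋₁ ≡ binom (m + m + 0) (suc m)
  b₋₁-sym = subst (λ x → binom x r ≡ binom x (suc m)) (sizes r) (binom-sym r (suc m))
    where
    sizes : ∀ r → r + suc (suc r) ≡ suc r + suc r + 0
    sizes = solve-∀
  absorbed : suc m * b₋₁ + m * b ≡ (m + m + 0) * b
  absorbed = trans (cong (λ x → suc m * x + m * b) b₋₁-sym) (binom-absorption (m + m + 0) m)
  forests*[m+1] : forests 1 m * suc m ≡ b
  forests*[m+1] = ℕₚ.+-cancelʳ-≡ ((m + m + 0) * b) _ _ (begin
    forests 1 m * suc m + (m + m + 0) * b        ≡⟨ cong (forests 1 m * suc m +_) absorbed ⟨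
    forests 1 m * suc m + (suc m * b₋₁ + m * b)  ≡⟨ factor (forests 1 m) m b₋₁ b ⟩
    suc m * (forests 1 m + b₋₁) + m * b          ≡⟨ cong (λ x → suc m * x + m * b) (forests-ballot m 0) ⟩
    suc m * b + m * b                            ≡⟨ expand m b ⟩
    b + (m + m + 0) * b                          ∎)
    where
    factor : ∀ g m s b → g * suc m + (suc m * s + m * b) ≡ suc m * (g + s) + m * b
    factor = solve-∀
    expand : ∀ m b → suc m * b + m * b ≡ b + (m + m + 0) * b
    expand = solve-∀
  two-times : ∀ m → 2 * m ≡ m + m + 0
  two-times = solve-∀
  central : (2 * m) C m ≡ forests 1 m * suc m
  central = begin
    (2 * m) C m      ≡⟨ binom≡C (2 * m) m ⟨
    binom (2 * m) m  ≡⟨ cong (λ x → binom x m) (two-times m) ⟩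
    b                ≡⟨ forests*[m+1] ⟨
    forests 1 m * suc m ∎

-- The Klein group inside ℝ³

module Reals (ℝ : RealNumbers) where

  open RealNumbers ℝ using (R; _≈_; -_; 0r; 1r; 0<1; +-mono-<; <-isStrictTotalOrder; isCommutativeRing)
    renaming (_+_ to _+ᵣ_; _*_ to _*ᵣ_; _<_ to _<ᵣ_)
  private
    ring : CommutativeRing _ _
    ring = record { isCommutativeRing = isCommutativeRing }
  open CommutativeRing ring
    using (+-cong; *-cong; -‿cong; zeroˡ; zeroʳ; *-identityˡ; +-identityˡ; +-identityʳ; -‿inverseʳ; +-comm; *-comm)
    renaming (refl to ≈-refl; sym to ≈-sym; trans to ≈-trans; setoid to ≈-setoid)
  open RingProperties (CommutativeRing.ring ring) using (-0#≈0#; -‿involutive; -‿distribˡ-*; -‿distribʳ-*; -‿+-comm)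
  module <ᵣ = IsStrictTotalOrder <-isStrictTotalOrder

  V : Set
  V = V3 ℝ

  infix 4 _≋_
  _≋_ : V → V → Set
  _≋_ = _≈₃_ ℝ

  ≋-refl : ∀ {x} → x ≋ x
  ≋-refl = ≈-refl , ≈-refl , ≈-refl

  ≋-sym : ∀ {x y} → x ≋ y → y ≋ x
  ≋-sym (p , q , r) = ≈-sym p , ≈-sym q , ≈-sym r

  ≋-trans : ∀ {x y z} → x ≋ y → y ≋ z → x ≋ z
  ≋-trans (p , q , r) (p′ , q′ , r′) = ≈-trans p p′ , ≈-trans q q′ , ≈-trans r r′

  ≋-setoid : Setoid _ _
  ≋-setoid = record { Carrier = V ; _≈_ = _≋_ ; isEquivalence = record { refl = ≋-refl ; sym = ≋-sym ; trans = ≋-trans } }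

  ⟦_⟧ : Bool → R
  ⟦ false ⟧ = 0r
  ⟦ true  ⟧ = 1r

  bit₁ bit₂ bit₃ : Klein → Bool
  bit₁ (p , q) = p ∧ not q
  bit₂ (p , q) = not p ∧ q
  bit₃ (p , q) = p ∧ q

  vec : Klein → V
  vec a = ⟦ bit₁ a ⟧ , ⟦ bit₂ a ⟧ , ⟦ bit₃ a ⟧

  negateIf : Bool → R → R
  negateIf false x = x
  negateIf true  x = - x

  signed : Bool → V → V
  signed s (x , y , z) = negateIf s x , negateIf s y , negateIf s z

  ⟦⟧-* : ∀ u v → ⟦ u ⟧ *ᵣ ⟦ v ⟧ ≈ ⟦ u ∧ v ⟧
  ⟦⟧-* false v     = zeroˡ _
  ⟦⟧-* true  false = zeroʳ _
  ⟦⟧-* true  true  = *-identityˡ _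

  sum-of-products : ∀ u v w x → T (not ((u ∧ v) ∧ (w ∧ x))) → ⟦ u ⟧ *ᵣ ⟦ v ⟧ +ᵣ ⟦ w ⟧ *ᵣ ⟦ x ⟧ ≈ ⟦ (u ∧ v) ∨ (w ∧ x) ⟧
  sum-of-products u v w x h = ≈-trans (+-cong (⟦⟧-* u v) (⟦⟧-* w x)) (add (u ∧ v) (w ∧ x) h)
    where
    add : ∀ p q → T (not (p ∧ q)) → ⟦ p ⟧ +ᵣ ⟦ q ⟧ ≈ ⟦ p ∨ q ⟧
    add false q     _ = +-identityˡ _
    add true  false _ = +-identityʳ _

  difference⁺ : ∀ u v w x → T (not (w ∧ x)) → ⟦ u ⟧ *ᵣ ⟦ v ⟧ +ᵣ - (⟦ w ⟧ *ᵣ ⟦ x ⟧) ≈ ⟦ u ∧ v ⟧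
  difference⁺ u v w x h = ≈-trans (+-cong (⟦⟧-* u v) (-‿cong (⟦⟧-* w x))) (drop (w ∧ x) h)
    where
    drop : ∀ q → T (not q) → ⟦ u ∧ v ⟧ +ᵣ - ⟦ q ⟧ ≈ ⟦ u ∧ v ⟧
    drop false _ = ≈-trans (+-cong ≈-refl -0#≈0#) (+-identityʳ _)

  difference⁻ : ∀ u v w x → T (not (u ∧ v)) → ⟦ u ⟧ *ᵣ ⟦ v ⟧ +ᵣ - (⟦ w ⟧ *ᵣ ⟦ x ⟧) ≈ - ⟦ w ∧ x ⟧
  difference⁻ u v w x h = ≈-trans (+-cong (⟦⟧-* u v) (-‿cong (⟦⟧-* w x))) (drop (u ∧ v) h)
    where
    drop : ∀ p → T (not p) → ⟦ p ⟧ +ᵣ - ⟦ w ∧ x ⟧ ≈ - ⟦ w ∧ x ⟧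
    drop false _ = +-identityˡ _

  join-row : ∀ a b → T (not ((bit₂ a ∧ bit₃ b) ∧ (bit₃ a ∧ bit₂ b))) → T (not ((bit₃ a ∧ bit₁ b) ∧ (bit₁ a ∧ bit₃ b))) →
             T (not ((bit₁ a ∧ bit₂ b) ∧ (bit₂ a ∧ bit₁ b))) →
             join ℝ (vec a) (vec b) ≋ (⟦ (bit₂ a ∧ bit₃ b) ∨ (bit₃ a ∧ bit₂ b) ⟧ , ⟦ (bit₃ a ∧ bit₁ b) ∨ (bit₁ a ∧ bit₃ b) ⟧ ,
                                       ⟦ (bit₁ a ∧ bit₂ b) ∨ (bit₂ a ∧ bit₁ b) ⟧)
  join-row a b h₁ h₂ h₃ =
    sum-of-products (bit₂ a) (bit₃ b) (bit₃ a) (bit₂ b) h₁ ,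
    sum-of-products (bit₃ a) (bit₁ b) (bit₁ a) (bit₃ b) h₂ ,
    sum-of-products (bit₁ a) (bit₂ b) (bit₂ a) (bit₁ b) h₃

  cross-row⁺ : ∀ a b → T (not (bit₃ a ∧ bit₂ b)) → T (not (bit₁ a ∧ bit₃ b)) → T (not (bit₂ a ∧ bit₁ b)) →
               cross ℝ (vec a) (vec b) ≋ (⟦ bit₂ a ∧ bit₃ b ⟧ , ⟦ bit₃ a ∧ bit₁ b ⟧ , ⟦ bit₁ a ∧ bit₂ b ⟧)
  cross-row⁺ a b h₁ h₂ h₃ =
    difference⁺ (bit₂ a) (bit₃ b) (bit₃ a) (bit₂ b) h₁ ,
    difference⁺ (bit₃ a) (bit₁ b) (bit₁ a) (bit₃ b) h₂ ,
    difference⁺ (bit₁ a) (bit₂ b) (bit₂ a) (bit₁ b) h₃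

  cross-row⁻ : ∀ a b → T (not (bit₂ a ∧ bit₃ b)) → T (not (bit₃ a ∧ bit₁ b)) → T (not (bit₁ a ∧ bit₂ b)) →
               cross ℝ (vec a) (vec b) ≋ signed true (⟦ bit₃ a ∧ bit₂ b ⟧ , ⟦ bit₁ a ∧ bit₃ b ⟧ , ⟦ bit₂ a ∧ bit₁ b ⟧)
  cross-row⁻ a b h₁ h₂ h₃ =
    difference⁻ (bit₂ a) (bit₃ b) (bit₃ a) (bit₂ b) h₁ ,
    difference⁻ (bit₃ a) (bit₁ b) (bit₁ a) (bit₃ b) h₂ ,
    difference⁻ (bit₁ a) (bit₂ b) (bit₂ a) (bit₁ b) h₃

  join-vec : ∀ a b → join ℝ (vec a) (vec b) ≋ vec (a ⋈ b)
  join-vec 𝟎 𝟎 = join-row 𝟎 𝟎 _ _ _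
  join-vec 𝟎 𝐢 = join-row 𝟎 𝐢 _ _ _
  join-vec 𝟎 𝐣 = join-row 𝟎 𝐣 _ _ _
  join-vec 𝟎 𝐤 = join-row 𝟎 𝐤 _ _ _
  join-vec 𝐢 𝟎 = join-row 𝐢 𝟎 _ _ _
  join-vec 𝐢 𝐢 = join-row 𝐢 𝐢 _ _ _
  join-vec 𝐢 𝐣 = join-row 𝐢 𝐣 _ _ _
  join-vec 𝐢 𝐤 = join-row 𝐢 𝐤 _ _ _
  join-vec 𝐣 𝟎 = join-row 𝐣 𝟎 _ _ _
  join-vec 𝐣 𝐢 = join-row 𝐣 𝐢 _ _ _
  join-vec 𝐣 𝐣 = join-row 𝐣 𝐣 _ _ _
  join-vec 𝐣 𝐤 = join-row 𝐣 𝐤 _ _ _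
  join-vec 𝐤 𝟎 = join-row 𝐤 𝟎 _ _ _
  join-vec 𝐤 𝐢 = join-row 𝐤 𝐢 _ _ _
  join-vec 𝐤 𝐣 = join-row 𝐤 𝐣 _ _ _
  join-vec 𝐤 𝐤 = join-row 𝐤 𝐤 _ _ _

  -- σ a b tells whether the cross product of the basis vectors a and b is the negated basis vector a ⋈ b.
  σ : Klein → Klein → Bool
  σ 𝐣 𝐢 = true
  σ 𝐤 𝐣 = true
  σ 𝐢 𝐤 = true
  σ _ _ = false

  cross-vec : ∀ a b → cross ℝ (vec a) (vec b) ≋ signed (σ a b) (vec (a ⋈ b))
  cross-vec 𝟎 𝟎 = cross-row⁺ 𝟎 𝟎 _ _ _
  cross-vec 𝟎 𝐢 = cross-row⁺ 𝟎 𝐢 _ _ _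
  cross-vec 𝟎 𝐣 = cross-row⁺ 𝟎 𝐣 _ _ _
  cross-vec 𝟎 𝐤 = cross-row⁺ 𝟎 𝐤 _ _ _
  cross-vec 𝐢 𝟎 = cross-row⁺ 𝐢 𝟎 _ _ _
  cross-vec 𝐢 𝐢 = cross-row⁺ 𝐢 𝐢 _ _ _
  cross-vec 𝐢 𝐣 = cross-row⁺ 𝐢 𝐣 _ _ _
  cross-vec 𝐢 𝐤 = cross-row⁻ 𝐢 𝐤 _ _ _
  cross-vec 𝐣 𝟎 = cross-row⁺ 𝐣 𝟎 _ _ _
  cross-vec 𝐣 𝐢 = cross-row⁻ 𝐣 𝐢 _ _ _
  cross-vec 𝐣 𝐣 = cross-row⁺ 𝐣 𝐣 _ _ _
  cross-vec 𝐣 𝐤 = cross-row⁺ 𝐣 𝐤 _ _ _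
  cross-vec 𝐤 𝟎 = cross-row⁺ 𝐤 𝟎 _ _ _
  cross-vec 𝐤 𝐢 = cross-row⁺ 𝐤 𝐢 _ _ _
  cross-vec 𝐤 𝐣 = cross-row⁻ 𝐤 𝐣 _ _ _
  cross-vec 𝐤 𝐤 = cross-row⁺ 𝐤 𝐤 _ _ _

  join-cong : ∀ {x x′ y y′} → x ≋ x′ → y ≋ y′ → join ℝ x y ≋ join ℝ x′ y′
  join-cong (p , q , r) (p′ , q′ , r′) =
    +-cong (*-cong q r′) (*-cong r q′) , +-cong (*-cong r p′) (*-cong p r′) , +-cong (*-cong p q′) (*-cong q p′)

  cross-cong : ∀ {x x′ y y′} → x ≋ x′ → y ≋ y′ → cross ℝ x y ≋ cross ℝ x′ y′
  cross-cong (p , q , r) (p′ , q′ , r′) =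
    +-cong (*-cong q r′) (-‿cong (*-cong r q′)) , +-cong (*-cong r p′) (-‿cong (*-cong p r′)) ,
    +-cong (*-cong p q′) (-‿cong (*-cong q p′))

  join-comm : ∀ x y → join ℝ x y ≋ join ℝ y x
  join-comm (α , β , γ) (α′ , β′ , γ′) = swap-sum β γ′ γ β′ , swap-sum γ α′ α γ′ , swap-sum α β′ β α′
    where
    swap-sum : ∀ a b c d → a *ᵣ b +ᵣ c *ᵣ d ≈ d *ᵣ c +ᵣ b *ᵣ a
    swap-sum a b c d = ≈-trans (+-comm _ _) (+-cong (*-comm c d) (*-comm a b))

  cross-anticomm : ∀ x y → cross ℝ x y ≋ signed true (cross ℝ y x)
  cross-anticomm (α , β , γ) (α′ , β′ , γ′) =
    swap-difference β γ′ γ β′ , swap-difference γ α′ α γ′ , swap-difference α β′ β α′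
    where
    open SetoidReasoning ≈-setoid
    swap-difference : ∀ a b c d → a *ᵣ b +ᵣ - (c *ᵣ d) ≈ - (d *ᵣ c +ᵣ - (b *ᵣ a))
    swap-difference a b c d = begin
      a *ᵣ b +ᵣ - (c *ᵣ d)         ≈⟨ +-comm _ _ ⟩
      - (c *ᵣ d) +ᵣ a *ᵣ b         ≈⟨ +-cong (-‿cong (*-comm c d)) (≈-trans (*-comm a b) (≈-sym (-‿involutive _))) ⟩
      - (d *ᵣ c) +ᵣ - - (b *ᵣ a)   ≈⟨ -‿+-comm _ _ ⟩
      - (d *ᵣ c +ᵣ - (b *ᵣ a))     ∎

  signed-cong : ∀ s {x y} → x ≋ y → signed s x ≋ signed s y
  signed-cong false p           = p
  signed-cong true  (p , q , r) = -‿cong p , -‿cong q , -‿cong r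

  signed-signed : ∀ s s′ x → signed s (signed s′ x) ≋ signed (s xor s′) x
  signed-signed false s′    x = ≋-refl
  signed-signed true  false x = ≋-refl
  signed-signed true  true  x = -‿involutive _ , -‿involutive _ , -‿involutive _

  cross-negateˡ : ∀ x y → cross ℝ (signed true x) y ≋ signed true (cross ℝ x y)
  cross-negateˡ (α , β , γ) (α′ , β′ , γ′) = negate β γ′ γ β′ , negate γ α′ α γ′ , negate α β′ β α′
    where
    negate : ∀ a b c d → (- a) *ᵣ b +ᵣ - ((- c) *ᵣ d) ≈ - (a *ᵣ b +ᵣ - (c *ᵣ d))
    negate a b c d = ≈-trans (+-cong (≈-sym (-‿distribˡ-* a b)) (-‿cong (≈-sym (-‿distribˡ-* c d)))) (-‿+-comm _ _)

  cross-negateʳ : ∀ x y → cross ℝ x (signed true y) ≋ signed true (cross ℝ x y)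
  cross-negateʳ (α , β , γ) (α′ , β′ , γ′) = negate β γ′ γ β′ , negate γ α′ α γ′ , negate α β′ β α′
    where
    negate : ∀ a b c d → a *ᵣ (- b) +ᵣ - (c *ᵣ (- d)) ≈ - (a *ᵣ b +ᵣ - (c *ᵣ d))
    negate a b c d = ≈-trans (+-cong (≈-sym (-‿distribʳ-* a b)) (-‿cong (≈-sym (-‿distribʳ-* c d)))) (-‿+-comm _ _)

  cross-signed : ∀ s s′ x y → cross ℝ (signed s x) (signed s′ y) ≋ signed (s xor s′) (cross ℝ x y)
  cross-signed false false x y = ≋-refl
  cross-signed false true  x y = cross-negateʳ x y
  cross-signed true  false x y = cross-negateˡ x y
  cross-signed true  true  x y =
    ≋-trans (cross-negateˡ x (signed true y)) (≋-trans (signed-cong true (cross-negateʳ x y)) (signed-signed true true _))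

  1≉0 : ¬ 1r ≈ 0r
  1≉0 e = <ᵣ.irrefl (≈-sym e) 0<1

  1≉-1 : ¬ 1r ≈ - 1r
  1≉-1 e = <ᵣ.irrefl (≈-sym (≈-trans (+-cong ≈-refl e) (-‿inverseʳ 1r))) 0<2
    where
    0<2 : 0r <ᵣ 1r +ᵣ 1r
    0<2 = <ᵣ.trans 0<1 (proj₂ <ᵣ.<-resp-≈ (+-identityˡ 1r) (+-mono-< 0r 1r 1r 0<1))

  negateIf-0 : ∀ s → negateIf s 0r ≈ 0r
  negateIf-0 false = ≈-refl
  negateIf-0 true  = -0#≈0#

  negateIf-1≉0 : ∀ s s′ → ¬ negateIf s 1r ≈ negateIf s′ 0r
  negateIf-1≉0 false s′ e = 1≉0 (≈-trans e (negateIf-0 s′))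
  negateIf-1≉0 true  s′ e = 1≉0 (≈-trans (≈-sym (-‿involutive 1r)) (≈-trans (-‿cong (≈-trans e (negateIf-0 s′))) -0#≈0#))

  negateIf-1≉1 : ∀ s → ¬ negateIf s 1r ≈ negateIf (not s) 1r
  negateIf-1≉1 false e = 1≉-1 e
  negateIf-1≉1 true  e = 1≉-1 (≈-sym e)

  signed-vec≉𝟎 : ∀ {e} → e ≢ 𝟎 → ∀ s s′ → ¬ signed s (vec e) ≋ signed s′ (vec 𝟎)
  signed-vec≉𝟎 {𝟎} e≢𝟎 _ _ _           = e≢𝟎 refl
  signed-vec≉𝟎 {𝐢} _   s s′ (p , _ , _) = negateIf-1≉0 s s′ p
  signed-vec≉𝟎 {𝐣} _   s s′ (_ , p , _) = negateIf-1≉0 s s′ p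
  signed-vec≉𝟎 {𝐤} _   s s′ (_ , _ , p) = negateIf-1≉0 s s′ p

  signed-vec≉negated : ∀ {e} → e ≢ 𝟎 → ∀ s → ¬ signed s (vec e) ≋ signed (not s) (vec e)
  signed-vec≉negated {𝟎} e≢𝟎 _ _         = e≢𝟎 refl
  signed-vec≉negated {𝐢} _   s (p , _ , _) = negateIf-1≉1 s p
  signed-vec≉negated {𝐣} _   s (_ , p , _) = negateIf-1≉1 s p
  signed-vec≉negated {𝐤} _   s (_ , _ , p) = negateIf-1≉1 s p

  module _ {n : ℕ} where

    JoinOp CrossOp : Term n → (Fin n → V) → V
    JoinOp  = termOp ℝ (join ℝ)
    CrossOp = termOp ℝ (cross ℝ)

    JoinOp-vec : ∀ t c → JoinOp t (vec ∘ c) ≋ vec (eval t c)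
    JoinOp-vec (var i) c = ≋-refl
    JoinOp-vec (a · b) c = ≋-trans (join-cong (JoinOp-vec a c) (JoinOp-vec b c)) (join-vec (eval a c) (eval b c))

    sign : Term n → Colouring → Bool
    sign (var _) c = false
    sign (a · b) c = (sign a c xor sign b c) xor σ (eval a c) (eval b c)

    CrossOp-vec : ∀ t c → CrossOp t (vec ∘ c) ≋ signed (sign t c) (vec (eval t c))
    CrossOp-vec (var i) c = ≋-refl
    CrossOp-vec (a · b) c =
      ≋-trans (cross-cong (CrossOp-vec a c) (CrossOp-vec b c))
      (≋-trans (cross-signed (sign a c) (sign b c) _ _)
      (≋-trans (signed-cong (sign a c xor sign b c) (cross-vec (eval a c) (eval b c)))
               (signed-signed (sign a c xor sign b c) (σ (eval a c) (eval b c)) _)))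

    JoinOp-separated : ∀ {t t′ : Term n} → Separates t t′ → ¬ SameOp ℝ (JoinOp t) (JoinOp t′)
    JoinOp-separated {t} {t′} (c , t≢𝟎 , t′≡𝟎) same = signed-vec≉𝟎 t≢𝟎 false false
      (≋-trans (≋-sym (JoinOp-vec t c))
        (≋-trans (same (vec ∘ c)) (subst (λ e → JoinOp t′ (vec ∘ c) ≋ vec e) t′≡𝟎 (JoinOp-vec t′ c))))

    CrossOp-separated : ∀ {t t′ : Term n} → Separates t t′ → ¬ SameOp ℝ (CrossOp t) (CrossOp t′)
    CrossOp-separated {t} {t′} (c , t≢𝟎 , t′≡𝟎) same = signed-vec≉𝟎 t≢𝟎 (sign t c) (sign t′ c)
      (≋-trans (≋-sym (CrossOp-vec t c)) (≋-trans (same (vec ∘ c))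
        (subst (λ e → CrossOp t′ (vec ∘ c) ≋ signed (sign t′ c) (vec e)) t′≡𝟎 (CrossOp-vec t′ c))))

    JoinOp-≈ᶜ : ∀ {t t′ : Term n} → t ≈ᶜ t′ → SameOp ℝ (JoinOp t) (JoinOp t′)
    JoinOp-≈ᶜ (var i)    v = ≋-refl
    JoinOp-≈ᶜ (keep p q) v = join-cong (JoinOp-≈ᶜ p v) (JoinOp-≈ᶜ q v)
    JoinOp-≈ᶜ (swap p q) v = ≋-trans (join-cong (JoinOp-≈ᶜ p v) (JoinOp-≈ᶜ q v)) (join-comm _ _)

    parity : ∀ {t t′ : Term n} → t ≈ᶜ t′ → Bool
    parity (var _)    = false
    parity (keep p q) = parity p xor parity q
    parity (swap p q) = (parity p xor parity q) xor true

    CrossOp-≈ᶜ : ∀ {t t′ : Term n} (p : t ≈ᶜ t′) v → CrossOp t v ≋ signed (parity p) (CrossOp t′ v)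
    CrossOp-≈ᶜ (var i) v = ≋-refl
    CrossOp-≈ᶜ (keep p q) v =
      ≋-trans (cross-cong (CrossOp-≈ᶜ p v) (CrossOp-≈ᶜ q v)) (cross-signed (parity p) (parity q) _ _)
    CrossOp-≈ᶜ (swap p q) v =
      ≋-trans (cross-cong (CrossOp-≈ᶜ p v) (CrossOp-≈ᶜ q v))
      (≋-trans (cross-signed (parity p) (parity q) _ _)
      (≋-trans (signed-cong (parity p xor parity q) (cross-anticomm _ _))
               (signed-signed (parity p xor parity q) true _)))

    CrossOp-swapped : ∀ {a b : Term n} → Linear (a · b) → ¬ SameOp ℝ (CrossOp (a · b)) (CrossOp (b · a))
    CrossOp-swapped {a} {b} lin same with eval-surjective lin {𝐢} (λ ())
    ... | c , ab≡𝐢 = signed-vec≉negated {𝐢} (λ ()) s (begin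
      signed s (vec 𝐢)                         ≈⟨ ≋-sym ab≈ ⟩
      CrossOp (a · b) (vec ∘ c)                ≈⟨ same (vec ∘ c) ⟩
      CrossOp (b · a) (vec ∘ c)                ≈⟨ cross-anticomm _ _ ⟩
      signed true (CrossOp (a · b) (vec ∘ c))  ≈⟨ signed-cong true ab≈ ⟩
      signed true (signed s (vec 𝐢))           ≈⟨ signed-signed true s _ ⟩
      signed (not s) (vec 𝐢)                   ∎)
      where
      s = sign (a · b) c
      ab≈ : CrossOp (a · b) (vec ∘ c) ≋ signed s (vec 𝐢)
      ab≈ = subst (λ e → CrossOp (a · b) (vec ∘ c) ≋ signed s (vec e)) ab≡𝐢 (CrossOp-vec (a · b) c)
      open SetoidReasoning ≋-setoid

module Counting (ℝ : RealNumbers) where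

  open Reals ℝ

  NumOps-from-Enumeration : ∀ {n k} {P Q : Term n → Set} {op : V → V → V} → Enumeration Q k → (∀ {t} → Q t → P t) →
    (∀ {t t′} → Q t → Q t′ → t ≢ t′ → ¬ SameOp ℝ (termOp ℝ op t) (termOp ℝ op t′)) →
    (∀ t → P t → ∃ λ t′ → Q t′ × SameOp ℝ (termOp ℝ op t) (termOp ℝ op t′)) →
    NumOps ℝ P op k
  NumOps-from-Enumeration {op = op} e Q⇒P separated cover = elem , Q⇒P ∘ elem-P , distinct , covered
    where
    open Enumeration e
    distinct : ∀ a b → SameOp ℝ (termOp ℝ op (elem a)) (termOp ℝ op (elem b)) → a ≡ b
    distinct a b same with elem a ≟ₜ elem b
    ... | yes e′ = elem-injective a b e′
    ... | no  ne = ⊥-elim (separated (elem-P a) (elem-P b) ne same)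
    covered : ∀ t → _ → ∃ λ a → SameOp ℝ (termOp ℝ op t) (termOp ℝ op (elem a))
    covered t pt with cover t pt
    ... | t′ , qt′ , same with elem-surjective t′ qt′
    ...   | a , refl = a , same

  join-full : ∀ m → s-ac ℝ (suc m) (join ℝ) (oddFactorial m)
  join-full m = NumOps-from-Enumeration (enumerate-CanonicalOn m ℕₚ.≤-refl) CanonicalOn⇒FullLinear separated cover
    where
    separated : ∀ {t t′} → CanonicalOn m t → CanonicalOn m t′ → t ≢ t′ → ¬ SameOp ℝ (JoinOp t) (JoinOp t′)
    separated {t} {t′} ct ct′ t≢t′ = JoinOp-separated {t = t} {t′}
      (separate-FullLinear {t = t} {t′} (proj₁ ct) (proj₁ ct′) (CanonicalOn⇒FullLinear ct) (CanonicalOn⇒FullLinear ct′) t≢t′)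
    cover : ∀ t → FullLinear t → ∃ λ t′ → CanonicalOn m t′ × SameOp ℝ (JoinOp t) (JoinOp t′)
    cover t full with canonical-form (FullLinear⇒Linear {t = t} full)
    ... | t′ , ct′ , t≈t′ =
      t′ , FullLinear⇒CanonicalOn {t = t′} ct′ (λ i → trans (sym (≈ᶜ⇒SameVars t≈t′ i)) (full i)) , JoinOp-≈ᶜ t≈t′

  bracketings : ∀ m {op} → (∀ {t t′ : Term (suc m)} → Separates t t′ → ¬ SameOp ℝ (termOp ℝ op t) (termOp ℝ op t′)) →
                s-br ℝ (suc m) op (forests 1 m)
  bracketings m {op} separated⇒distinct =
    NumOps-from-Enumeration enumerate-bracketings id separated (λ t bt → t , bt , λ _ → ≋-refl)
    where
    separated : ∀ {t t′} → Bracketing t → Bracketing t′ → t ≢ t′ → ¬ SameOp ℝ (termOp ℝ op t) (termOp ℝ op t′)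
    separated {t} {t′} bt bt′ t≢t′ = separated⇒distinct {t} {t′}
      (separate-FullLinear {t = t} {t′} (Bracketing⇒Canonical bt) (Bracketing⇒Canonical bt′) (proj₁ bt) (proj₁ bt′) t≢t′)

  module _ {m : ℕ} where

    CrossOp-orient : ∀ s {t : Term (suc (suc m))} → FullLinear t →
                     ∀ v → CrossOp (orient (flag s) t) v ≋ signed s (CrossOp t v)
    CrossOp-orient false _ v = ≋-refl
    CrossOp-orient true {var x} full = ⊥-elim (¬FullLinear-var full)
    CrossOp-orient true {a · b} _ v = cross-anticomm _ _

    orientations-distinct : ∀ {t : Term (suc (suc m))} → FullLinear t → ∀ s s′ →
                            SameOp ℝ (CrossOp (orient s t)) (CrossOp (orient s′ t)) → s ≡ s′
    orientations-distinct {var x} full _ _ _ = ⊥-elim (¬FullLinear-var full)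
    orientations-distinct {a · b} full fz      fz      _    = refl
    orientations-distinct {a · b} full (fs fz) (fs fz) _    = refl
    orientations-distinct {a · b} full fz      (fs fz) same =
      ⊥-elim (CrossOp-swapped {a = a} {b = b} (FullLinear⇒Linear full) same)
    orientations-distinct {a · b} full (fs fz) fz      same =
      ⊥-elim (CrossOp-swapped {a = a} {b = b} (FullLinear⇒Linear full) (≋-sym ∘ same))

  cross-full : ∀ m → s-ac ℝ (suc (suc m)) (cross ℝ) (oddFactorial (suc m) * 2)
  cross-full m = terms , full , distinct , cover
    where
    open Enumeration (enumerate-CanonicalOn {suc m} (suc m) ℕₚ.≤-refl)

    split : Fin (oddFactorial (suc m) * 2) → Fin (oddFactorial (suc m)) × Fin 2
    split = Fin.remQuot {oddFactorial (suc m)} 2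

    terms : Fin (oddFactorial (suc m) * 2) → Term (suc (suc m))
    terms c = orient (proj₂ (split c)) (elem (proj₁ (split c)))

    full : ∀ c → FullLinear (terms c)
    full c i = trans (occ-orient (proj₂ (split c)) _ i) (CanonicalOn⇒FullLinear (elem-P (proj₁ (split c))) i)

    distinct-split : ∀ b s b′ s′ → SameOp ℝ (CrossOp (orient s (elem b))) (CrossOp (orient s′ (elem b′))) →
                     (b , s) ≡ (b′ , s′)
    distinct-split b s b′ s′ same with elem b ≟ₜ elem b′
    ... | no b≢b′ with separate-FullLinear {t = elem b} {elem b′} (proj₁ (elem-P b)) (proj₁ (elem-P b′))
                         (CanonicalOn⇒FullLinear (elem-P b)) (CanonicalOn⇒FullLinear (elem-P b′)) b≢b′
    ...   | c , b≢𝟎 , b′≡𝟎 = ⊥-elim (CrossOp-separated {t = orient s (elem b)} {orient s′ (elem b′)}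
      (c , subst (_≢ 𝟎) (sym (eval-orient s (elem b) c)) b≢𝟎 , trans (eval-orient s′ (elem b′) c) b′≡𝟎) same)
    distinct-split b s b′ s′ same | yes e with elem-injective b b′ e
    ... | refl = cong (b ,_) (orientations-distinct (CanonicalOn⇒FullLinear (elem-P b)) s s′ same)

    distinct : ∀ c c′ → SameOp ℝ (CrossOp (terms c)) (CrossOp (terms c′)) → c ≡ c′
    distinct c c′ same = remQuot-injective (oddFactorial (suc m)) (distinct-split _ _ _ _ same)

    cover : ∀ t → FullLinear t → ∃ λ c → SameOp ℝ (CrossOp t) (CrossOp (terms c))
    cover t full-t with canonical-form (FullLinear⇒Linear {t = t} full-t)
    ... | t′ , ct′ , t≈t′
      with elem-surjective t′ (FullLinear⇒CanonicalOn {t = t′} ct′ (λ i → trans (sym (≈ᶜ⇒SameVars t≈t′ i)) (full-t i)))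
    ...   | b , refl = Fin.combine b (flag (parity t≈t′)) , λ v → begin
      CrossOp t v                                      ≈⟨ CrossOp-≈ᶜ t≈t′ v ⟩
      signed (parity t≈t′) (CrossOp (elem b) v)        ≈⟨ CrossOp-orient (parity t≈t′) (CanonicalOn⇒FullLinear (elem-P b)) v ⟨
      CrossOp (orient (flag (parity t≈t′)) (elem b)) v ≡⟨ cong (λ p → CrossOp (orient (proj₂ p) (elem (proj₁ p))) v)
                                                             (Finₚ.remQuot-combine b (flag (parity t≈t′))) ⟨
      CrossOp (terms (Fin.combine b (flag (parity t≈t′)))) v ∎
      where open SetoidReasoning ≋-setoid

corollary5p6 : (ℝ : RealNumbers) →
    (∀ (n : ℕ) → 1 ≤ n → s-ac ℝ n (join ℝ) (DoubleFact (n ∸ 1))) ×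
    (∀ (n : ℕ) → 2 ≤ n → s-ac ℝ n (cross ℝ) (2 * DoubleFact (n ∸ 1))) ×
    (∀ (n : ℕ) → 1 ≤ n → s-br ℝ n (cross ℝ) (Catalan (n ∸ 1)) × s-br ℝ n (join ℝ) (Catalan (n ∸ 1)))
corollary5p6 ℝ = join-count , cross-count , bracketing-count
  where
  open Reals ℝ using (JoinOp-separated; CrossOp-separated)
  open Counting ℝ
  join-count : ∀ n → 1 ≤ n → s-ac ℝ n (join ℝ) (DoubleFact (n ∸ 1))
  join-count (suc m) _ = subst (s-ac ℝ (suc m) (join ℝ)) (sym (DoubleFact≡oddFactorial m)) (join-full m)
  cross-count : ∀ n → 2 ≤ n → s-ac ℝ n (cross ℝ) (2 * DoubleFact (n ∸ 1))
  cross-count (suc zero) (s≤s ())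
  cross-count (suc (suc m)) _ = subst (s-ac ℝ (suc (suc m)) (cross ℝ))
    (trans (ℕₚ.*-comm (oddFactorial (suc m)) 2) (cong (2 *_) (sym (DoubleFact≡oddFactorial (suc m))))) (cross-full m)
  bracketing-count : ∀ n → 1 ≤ n → s-br ℝ n (cross ℝ) (Catalan (n ∸ 1)) × s-br ℝ n (join ℝ) (Catalan (n ∸ 1))
  bracketing-count (suc m) _ =
    subst (s-br ℝ (suc m) (cross ℝ)) (sym (Catalan≡forests m)) (bracketings m (λ {t} {t′} → CrossOp-separated {t = t} {t′})) ,
    subst (s-br ℝ (suc m) (join ℝ)) (sym (Catalan≡forests m)) (bracketings m (λ {t} {t′} → JoinOp-separated {t = t} {t′}))
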